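{- Let $\{G_n^*(x)\}$ (of Lucas type) and $\{G_n'(x)\}$ (of Fibonacci type) be equivalent generalized Fibonacci polynomial sequences, and let $m,n$ be positive integers. Then (1) $\gcd(G'_{m+n+1}(x),G^*_n(x))=\gcd(G^*_{m+1}(x),G^*_n(x))$; (2) if $m>n$, then $\gcd(G'_{m-n+1}(x),G^*_n(x))=\gcd(G^*_{m+1}(x),G^*_n(x))$; (3) if $m<n$, then $\gcd(G'_{n-m+1}(x),G^*_n(x))=\gcd(G^*_{m-1}(x),G^*_n(x))$.
   Context: All polynomials lie in $\mathbb{Z}[x]$ and $\gcd$ denotes the greatest common divisor in $\mathbb{Z}[x]$ (determined up to sign). A generalized Fibonacci polynomial (GFP) sequence $\{G_n(x)\}_{n\ge0}$ is given by $G_0(x)=p_0(x)$, $G_1(x)=p_1(x)$ and $G_n(x)=d(x)G_{n-1}(x)+g(x)G_{n-2}(x)$ for $n\ge 2$, where $p_0(x)$ is a constant and $p_1(x),d(x),g(x)$ are nonzero polynomials in $\mathbb{Z}[x]$ with $\gcd(d(x),g(x))=1$; as in the paper it is assumed that $d(x)^2+4g(x)>0$. Let $a,b$ be the roots of $z^2-d(x)z-g(x)=0$. The sequence is of Lucas type if $p_0\ne 0$, $2p_1(x)=p_0\,d(x)$, $|p_0|\in\{1,2\}$, and $\gcd(p_0,p_1(x))=\gcd(p_0,d(x))=\gcd(p_0,g(x))=1$; then, with $\alpha=2/p_0$, $G_n=(a^n+b^n)/\alpha$ (denoted $G_n^*$). It is of Fibonacci type if $p_0=0$ and $p_1=1$;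 then $G_n=(a^n-b^n)/(a-b)$ (denoted $G_n'$). A Lucas-type and a Fibonacci-type sequence are equivalent if they are defined with the same $d(x)$ and $g(x)$. -}

module Defs where

open import Data.Nat using (ℕ; zero; suc)
open import Data.Integer as ℤ using (ℤ; +_; ∣_∣)
open import Data.Rational as ℚ using (ℚ)
open import Data.List using (List; []; _∷_; map)
open import Data.Product using (Σ; _×_; _,_; proj₁; proj₂)
open import Data.Sum using (_⊎_)
open import Relation.Binary.PropositionalEquality using (_≡_)
open import Relation.Nullary using (¬_)

-- Polynomials in ℤ[x], represented by coefficient lists
-- (constant term first).  Trailing zeros are allowed; equality of
-- polynomials is coefficientwise equality (_≈P_).

Poly : Set
Poly = List ℤ

coeff : Poly → ℕ → ℤ
coeff []      _       = + 0
coeff (a ∷ p) zero    = a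
coeff (a ∷ p) (suc k) = coeff p k

_≈P_ : Poly → Poly → Set
p ≈P q = ∀ k → coeff p k ≡ coeff q k

infix 4 _≈P_ _∣P_

0P : Poly
0P = []

const : ℤ → Poly
const c = c ∷ []

1P : Poly
1P = const (+ 1)

infixl 6 _+P_
infixl 7 _*P_ _·P_

_+P_ : Poly → Poly → Poly
[]      +P q       = q
(a ∷ p) +P []      = a ∷ p
(a ∷ p) +P (b ∷ q) = (a ℤ.+ b) ∷ (p +P q)

_·P_ : ℤ → Poly → Poly
c ·P p = map (c ℤ.*_) p

_*P_ : Poly → Poly → Poly
[]      *P q = []
(a ∷ p) *P q = (a ·P q) +P (+ 0 ∷ (p *P q))

eval : Poly → ℚ → ℚ
eval []      x = ℚ.0ℚ
eval (a ∷ p) x = (a ℚ./ 1) ℚ.+ x ℚ.* eval p x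

_∣P_ : Poly → Poly → Set
a ∣P b = Σ Poly λ c → c *P a ≈P b

-- h is a greatest common divisor of a and b in ℤ[x]
-- (determined only up to sign)
IsGCD : Poly → Poly → Poly → Set
IsGCD a b h = (h ∣P a) × (h ∣P b) × (∀ e → e ∣P a → e ∣P b → e ∣P h)

SameGCD : Poly → Poly → Poly → Poly → Set
SameGCD a b c d = ∀ h → (IsGCD a b h → IsGCD c d h) × (IsGCD c d h → IsGCD a b h)

GFPpair : Poly → Poly → Poly → Poly → ℕ → Poly × Poly
GFPpair p0 p1 d g zero    = p0 , p1
GFPpair p0 p1 d g (suc n) =
  let (u , v) = GFPpair p0 p1 d g n in v , (d *P v +P g *P u)

GFP : Poly → Poly → Poly → Poly → ℕ → Poly
GFP p0 p1 d g n = proj₁ (GFPpair p0 p1 d g n)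

GFPParams : Poly → Poly → Set
GFPParams d g =
  ¬ (d ≈P 0P) × ¬ (g ≈P 0P) × IsGCD d g 1P
  × (∀ (x : ℚ) → ℚ.0ℚ ℚ.< eval (d *P d +P (+ 4) ·P g) x)

LucasType : ℤ → Poly → Poly → Poly → Set
LucasType p0 p1 d g =
  ¬ (p0 ≡ + 0) × ¬ (p1 ≈P 0P)
  × ((+ 2) ·P p1 ≈P p0 ·P d)
  × (∣ p0 ∣ ≡ 1 ⊎ ∣ p0 ∣ ≡ 2)
  × IsGCD (const p0) p1 1P × IsGCD (const p0) d 1P × IsGCD (const p0) g 1P

Gstar : ℤ → Poly → Poly → Poly → ℕ → Poly
Gstar p0 p1 d g = GFP (const p0) p1 d g

Gprime : Poly → Poly → ℕ → Poly
Gprime d g = GFP 0P 1P d g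

-- All three identities come from the addition formula
-- G_{j+1+r} = G′_{j+1} G_{r+1} + g G′_j G_r (valid for any initial values) and the
-- relation p₀ G′_{n+1} = p₁ G′_n + G*_n: they turn divisibility by a common divisor e of
-- the pair into divisibility of products, which is then cancelled using that e is coprime
-- to g and to consecutive Lucas terms.
--
-- The cancellation needs Euclid's lemma in ℤ[x] (gcd(a, b) = 1 and a ∣ bc imply a ∣ c),
-- and ℤ[x] is not a Bézout domain. Pseudo-division of a by b produces a last non-zero
-- pseudo-remainder h in the ideal (a, b) that divides l·a and l·b for a non-zero integer
-- l; removing the primes of l one at a time with Gauss's lemma turns h into a common
-- divisor of a and b of the same degree, so h is a non-zero constant k. Then a ∣ k·c,
-- and the primes of k are cancelled again by Gauss's lemma, since no prime divides all
-- coefficients of both a and b.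

module Submission where

open import Defs
open import Algebra.Bundles using (CommutativeRing; Semiring)
open import Data.Empty using (⊥-elim)
open import Data.Integer as ℤ using (ℤ; +_; -[1+_]; ∣_∣)
open import Data.Integer.Base using (≢-nonZero)
import Data.Integer.Properties as ℤ
open import Data.Integer.Divisibility.Signed as ℤ∣ using (divides) renaming (_∣_ to _∣ℤ_)
import Data.Integer.Tactic.RingSolver as ℤ-Solver
open import Data.List using ([]; _∷_; length)
open import Data.List.Relation.Unary.All using (All; []; _∷_)
open import Data.Maybe using (nothing)
open import Data.Nat as ℕ using (ℕ; zero; suc; z≤n; s≤s)
import Data.Nat.Properties as ℕ
open import Data.Nat.Induction using (<-wellFounded)
open import Data.Nat.Divisibility as ℕ∣ using () renaming (_∣_ to _∣ℕ_)
open import Data.Nat.ListAction using (product)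
open import Data.Nat.Primality using (Prime; euclidsLemma; prime⇒nonTrivial)
open import Data.Nat.Primality.Factorisation using (factorise)
open import Data.Product using (Σ-syntax; ∃-syntax; _×_; _,_; proj₁; proj₂)
open import Data.Sum using (_⊎_; inj₁; inj₂; [_,_]′)
open import Function using (_∘_; id; _⇔_; mk⇔; Equivalence)
open import Function.Properties.Equivalence using () renaming (sym to ⇔-sym)
open import Induction.WellFounded using (Acc; acc)
open import Level using (0ℓ)
open import Relation.Binary.PropositionalEquality
open import Relation.Nullary using (¬_; Dec; yes; no)
import Relation.Binary.Reasoning.Setoid as SetoidReasoning
import Tactic.RingSolver.Core.AlmostCommutativeRing as ACR
open import Tactic.RingSolver using (solve-∀)

-- The ring ℤ[x]

module Pointwise where
  open import Data.Integer using (_+_; _*_; -_)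
  open ≡-Reasoning

  shift : Poly → Poly
  shift p = + 0 ∷ p

  coeff-+P : ∀ p q k → coeff (p +P q) k ≡ coeff p k + coeff q k
  coeff-+P []      q       k       = sym (ℤ.+-identityˡ _)
  coeff-+P (a ∷ p) []      k       = sym (ℤ.+-identityʳ _)
  coeff-+P (a ∷ p) (b ∷ q) zero    = refl
  coeff-+P (a ∷ p) (b ∷ q) (suc k) = coeff-+P p q k

  coeff-·P : ∀ c p k → coeff (c ·P p) k ≡ c * coeff p k
  coeff-·P c []      k       = sym (ℤ.*-zeroʳ c)
  coeff-·P c (a ∷ p) zero    = refl
  coeff-·P c (a ∷ p) (suc k) = coeff-·P c p k

  coeff-·P+P : ∀ c p q k → coeff (c ·P p +P q) k ≡ c * coeff p k + coeff q k
  coeff-·P+P c p q k = trans (coeff-+P (c ·P p) q k) (cong (_+ coeff q k) (coeff-·P c p k))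

  coeff-∷*P-zero : ∀ a p q → coeff ((a ∷ p) *P q) zero ≡ a * coeff q zero
  coeff-∷*P-zero a p q = trans (coeff-·P+P a q (shift (p *P q)) zero) (ℤ.+-identityʳ _)

  coeff-∷*P-suc : ∀ a p q k → coeff ((a ∷ p) *P q) (suc k) ≡ a * coeff q (suc k) + coeff (p *P q) k
  coeff-∷*P-suc a p q k = coeff-·P+P a q (shift (p *P q)) (suc k)

  +P-cong : ∀ p p′ q q′ → p ≈P p′ → q ≈P q′ → p +P q ≈P p′ +P q′
  +P-cong p p′ q q′ p≈p′ q≈q′ k =
    trans (coeff-+P p q k) (trans (cong₂ _+_ (p≈p′ k) (q≈q′ k)) (sym (coeff-+P p′ q′ k)))

  ·P-congʳ : ∀ c p p′ → p ≈P p′ → c ·P p ≈P c ·P p′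
  ·P-congʳ c p p′ p≈p′ k =
    trans (coeff-·P c p k) (trans (cong (c *_) (p≈p′ k)) (sym (coeff-·P c p′ k)))

  shift-[] : shift [] ≈P []
  shift-[] zero    = refl
  shift-[] (suc k) = refl

  shift-cong : ∀ p p′ → p ≈P p′ → shift p ≈P shift p′
  shift-cong p p′ p≈p′ zero    = refl
  shift-cong p p′ p≈p′ (suc k) = p≈p′ k

  +P-comm : ∀ p q → p +P q ≈P q +P p
  +P-comm p q k = trans (coeff-+P p q k) (trans (ℤ.+-comm (coeff p k) _) (sym (coeff-+P q p k)))

  +P-assoc : ∀ p q r → (p +P q) +P r ≈P p +P (q +P r)
  +P-assoc p q r k = begin
    coeff ((p +P q) +P r) k              ≡⟨ coeff-+P (p +P q) r k ⟩
    coeff (p +P q) k + coeff r k         ≡⟨ cong (_+ coeff r k) (coeff-+P p q k) ⟩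
    coeff p k + coeff q k + coeff r k    ≡⟨ ℤ.+-assoc (coeff p k) (coeff q k) (coeff r k) ⟩
    coeff p k + (coeff q k + coeff r k)  ≡⟨ cong (λ z → coeff p k + z) (coeff-+P q r k) ⟨
    coeff p k + coeff (q +P r) k         ≡⟨ coeff-+P p (q +P r) k ⟨
    coeff (p +P (q +P r)) k              ∎

  +P-identityʳ : ∀ p → p +P [] ≈P p
  +P-identityʳ p k = trans (coeff-+P p [] k) (ℤ.+-identityʳ (coeff p k))

  negP : Poly → Poly
  negP p = -[1+ 0 ] ·P p

  +P-inverseˡ : ∀ p → negP p +P p ≈P []
  +P-inverseˡ p k = begin
    coeff (negP p +P p) k           ≡⟨ coeff-+P (negP p) p k ⟩
    coeff (negP p) k + coeff p k    ≡⟨ cong (_+ coeff p k) (coeff-·P -[1+ 0 ] p k) ⟩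
    -[1+ 0 ] * coeff p k + coeff p k ≡⟨ cong (_+ coeff p k) (ℤ.-1*i≡-i (coeff p k)) ⟩
    - coeff p k + coeff p k         ≡⟨ ℤ.+-inverseˡ (coeff p k) ⟩
    + 0                             ∎

  ·P-·P : ∀ a b p → a ·P (b ·P p) ≈P (a * b) ·P p
  ·P-·P a b p k = begin
    coeff (a ·P (b ·P p)) k ≡⟨ coeff-·P a (b ·P p) k ⟩
    a * coeff (b ·P p) k    ≡⟨ cong (a *_) (coeff-·P b p k) ⟩
    a * (b * coeff p k)     ≡⟨ ℤ.*-assoc a b (coeff p k) ⟨
    a * b * coeff p k       ≡⟨ coeff-·P (a * b) p k ⟨
    coeff ((a * b) ·P p) k  ∎

  ·P-cancelˡ : ∀ c p q → c ≢ + 0 → c ·P p ≈P c ·P q → p ≈P q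
  ·P-cancelˡ c p q c≢0 cp≈cq k = ℤ.*-cancelˡ-≡ c (coeff p k) (coeff q k) {{≢-nonZero c≢0}}
    (trans (sym (coeff-·P c p k)) (trans (cp≈cq k) (coeff-·P c q k)))

  *P-zeroʳ : ∀ p → p *P [] ≈P []
  *P-zeroʳ []      k       = refl
  *P-zeroʳ (a ∷ p) zero    = refl
  *P-zeroʳ (a ∷ p) (suc k) = *P-zeroʳ p k

  *P-congʳ : ∀ p q q′ → q ≈P q′ → p *P q ≈P p *P q′
  *P-congʳ []      q q′ q≈q′ k = refl
  *P-congʳ (a ∷ p) q q′ q≈q′ =
    +P-cong (a ·P q) (a ·P q′) _ _ (·P-congʳ a q q′ q≈q′) (shift-cong _ _ (*P-congʳ p q q′ q≈q′))

  ·P-*P : ∀ c p q → (c ·P p) *P q ≈P c ·P (p *P q)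
  ·P-*P c []      q k = refl
  ·P-*P c (a ∷ p) q zero = begin
    coeff ((c * a ∷ c ·P p) *P q) zero ≡⟨ coeff-∷*P-zero (c * a) (c ·P p) q ⟩
    c * a * coeff q zero               ≡⟨ ℤ.*-assoc c a (coeff q zero) ⟩
    c * (a * coeff q zero)             ≡⟨ cong (c *_) (coeff-∷*P-zero a p q) ⟨
    c * coeff ((a ∷ p) *P q) zero      ≡⟨ coeff-·P c ((a ∷ p) *P q) zero ⟨
    coeff (c ·P ((a ∷ p) *P q)) zero   ∎
  ·P-*P c (a ∷ p) q (suc k) = begin
    coeff ((c * a ∷ c ·P p) *P q) (suc k)                 ≡⟨ coeff-∷*P-suc (c * a) (c ·P p) q k ⟩
    c * a * coeff q (suc k) + coeff ((c ·P p) *P q) k     ≡⟨ cong₂ _+_ (ℤ.*-assoc c a (coeff q (suc k)))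
                                                                     (trans (·P-*P c p q k) (coeff-·P c (p *P q) k)) ⟩
    c * (a * coeff q (suc k)) + c * coeff (p *P q) k      ≡⟨ ℤ.*-distribˡ-+ c _ _ ⟨
    c * (a * coeff q (suc k) + coeff (p *P q) k)          ≡⟨ cong (c *_) (coeff-∷*P-suc a p q k) ⟨
    c * coeff ((a ∷ p) *P q) (suc k)                      ≡⟨ coeff-·P c ((a ∷ p) *P q) (suc k) ⟨
    coeff (c ·P ((a ∷ p) *P q)) (suc k)                   ∎

  shift-*P : ∀ p q → shift p *P q ≈P shift (p *P q)
  shift-*P p q k = begin
    coeff (+ 0 ·P q +P shift (p *P q)) k          ≡⟨ coeff-+P (+ 0 ·P q) (shift (p *P q)) k ⟩
    coeff (+ 0 ·P q) k + coeff (shift (p *P q)) k ≡⟨ cong (_+ coeff (shift (p *P q)) k) (coeff-·P (+ 0) q k) ⟩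
    + 0 * coeff q k + coeff (shift (p *P q)) k    ≡⟨ cong (_+ coeff (shift (p *P q)) k) (ℤ.*-zeroˡ (coeff q k)) ⟩
    + 0 + coeff (shift (p *P q)) k                ≡⟨ ℤ.+-identityˡ _ ⟩
    coeff (shift (p *P q)) k                      ∎

  *P-identityˡ : ∀ p → 1P *P p ≈P p
  *P-identityˡ p k = begin
    coeff (+ 1 ·P p +P shift []) k  ≡⟨ coeff-+P (+ 1 ·P p) (shift []) k ⟩
    coeff (+ 1 ·P p) k + coeff (shift []) k ≡⟨ cong₂ _+_ (coeff-·P (+ 1) p k) (shift-[] k) ⟩
    + 1 * coeff p k + + 0           ≡⟨ ℤ.+-identityʳ _ ⟩
    + 1 * coeff p k                 ≡⟨ ℤ.*-identityˡ (coeff p k) ⟩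
    coeff p k                       ∎

  *P-distribʳ : ∀ p p′ q → (p +P p′) *P q ≈P p *P q +P p′ *P q
  *P-distribʳ []      p′       q k = refl
  *P-distribʳ (a ∷ p) []       q k = sym (+P-identityʳ ((a ∷ p) *P q) k)
  *P-distribʳ (a ∷ p) (b ∷ p′) q zero = begin
    coeff (((a + b) ∷ (p +P p′)) *P q) zero            ≡⟨ coeff-∷*P-zero (a + b) (p +P p′) q ⟩
    (a + b) * coeff q zero                             ≡⟨ ℤ.*-distribʳ-+ (coeff q zero) a b ⟩
    a * coeff q zero + b * coeff q zero                ≡⟨ cong₂ _+_ (coeff-∷*P-zero a p q) (coeff-∷*P-zero b p′ q) ⟨
    coeff ((a ∷ p) *P q) zero + coeff ((b ∷ p′) *P q) zero ≡⟨ coeff-+P ((a ∷ p) *P q) ((b ∷ p′) *P q) zero ⟨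
    coeff ((a ∷ p) *P q +P (b ∷ p′) *P q) zero         ∎
  *P-distribʳ (a ∷ p) (b ∷ p′) q (suc k) = begin
    coeff (((a + b) ∷ (p +P p′)) *P q) (suc k)
      ≡⟨ coeff-∷*P-suc (a + b) (p +P p′) q k ⟩
    (a + b) * x + coeff ((p +P p′) *P q) k
      ≡⟨ cong (λ z → (a + b) * x + z) (trans (*P-distribʳ p p′ q k) (coeff-+P (p *P q) (p′ *P q) k)) ⟩
    (a + b) * x + (coeff (p *P q) k + coeff (p′ *P q) k)
      ≡⟨ rearrange a b x (coeff (p *P q) k) (coeff (p′ *P q) k) ⟩
    (a * x + coeff (p *P q) k) + (b * x + coeff (p′ *P q) k)
      ≡⟨ cong₂ _+_ (coeff-∷*P-suc a p q k) (coeff-∷*P-suc b p′ q k) ⟨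
    coeff ((a ∷ p) *P q) (suc k) + coeff ((b ∷ p′) *P q) (suc k)
      ≡⟨ coeff-+P ((a ∷ p) *P q) ((b ∷ p′) *P q) (suc k) ⟨
    coeff ((a ∷ p) *P q +P (b ∷ p′) *P q) (suc k) ∎
    where
    x = coeff q (suc k)
    rearrange : ∀ a b x y z → (a + b) * x + (y + z) ≡ (a * x + y) + (b * x + z)
    rearrange = ℤ-Solver.solve-∀

  *P-∷ʳ : ∀ q a p → q *P (a ∷ p) ≈P a ·P q +P shift (q *P p)
  *P-∷ʳ []      a p zero    = refl
  *P-∷ʳ []      a p (suc k) = refl
  *P-∷ʳ (b ∷ q) a p zero    = begin
    coeff ((b ∷ q) *P (a ∷ p)) zero                     ≡⟨ coeff-∷*P-zero b q (a ∷ p) ⟩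
    b * a                                               ≡⟨ ℤ.*-comm b a ⟩
    a * b                                               ≡⟨ ℤ.+-identityʳ (a * b) ⟨
    a * b + + 0                                         ≡⟨ coeff-+P (a ·P (b ∷ q)) (shift ((b ∷ q) *P p)) zero ⟨
    coeff (a ·P (b ∷ q) +P shift ((b ∷ q) *P p)) zero   ∎
  *P-∷ʳ (b ∷ q) a p (suc k) = begin
    coeff ((b ∷ q) *P (a ∷ p)) (suc k)
      ≡⟨ coeff-∷*P-suc b q (a ∷ p) k ⟩
    b * coeff p k + coeff (q *P (a ∷ p)) k
      ≡⟨ cong (λ z → b * coeff p k + z) (*P-∷ʳ q a p k) ⟩
    b * coeff p k + coeff (a ·P q +P shift (q *P p)) k
      ≡⟨ cong (λ z → b * coeff p k + z) (coeff-·P+P a q (shift (q *P p)) k) ⟩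
    b * coeff p k + (a * coeff q k + coeff (shift (q *P p)) k)
      ≡⟨ exchange (b * coeff p k) (a * coeff q k) (coeff (shift (q *P p)) k) ⟩
    a * coeff q k + (b * coeff p k + coeff (shift (q *P p)) k)
      ≡⟨ cong (λ z → a * coeff q k + z) (coeff-·P+P b p (shift (q *P p)) k) ⟨
    a * coeff q k + coeff ((b ∷ q) *P p) k
      ≡⟨ coeff-·P+P a (b ∷ q) (shift ((b ∷ q) *P p)) (suc k) ⟨
    coeff (a ·P (b ∷ q) +P shift ((b ∷ q) *P p)) (suc k) ∎
    where
    exchange : ∀ x y z → x + (y + z) ≡ y + (x + z)
    exchange = ℤ-Solver.solve-∀

  *P-comm : ∀ p q → p *P q ≈P q *P p
  *P-comm []      q k = sym (*P-zeroʳ q k)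
  *P-comm (a ∷ p) q k = begin
    coeff (a ·P q +P shift (p *P q)) k ≡⟨ +P-cong (a ·P q) (a ·P q) _ _ (λ _ → refl) (shift-cong _ _ (*P-comm p q)) k ⟩
    coeff (a ·P q +P shift (q *P p)) k ≡⟨ *P-∷ʳ q a p k ⟨
    coeff (q *P (a ∷ p)) k             ∎

  *P-assoc : ∀ p q r → (p *P q) *P r ≈P p *P (q *P r)
  *P-assoc []      q r k = refl
  *P-assoc (a ∷ p) q r k = begin
    coeff ((a ·P q +P shift (p *P q)) *P r) k             ≡⟨ *P-distribʳ (a ·P q) (shift (p *P q)) r k ⟩
    coeff ((a ·P q) *P r +P shift (p *P q) *P r) k
      ≡⟨ +P-cong ((a ·P q) *P r) (a ·P (q *P r)) (shift (p *P q) *P r) (shift (p *P (q *P r))) (·P-*P a q r)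
                 (λ j → trans (shift-*P (p *P q) r j) (shift-cong _ _ (*P-assoc p q r) j)) k ⟩
    coeff (a ·P (q *P r) +P shift (p *P (q *P r))) k      ∎

open Pointwise using (shift; negP; coeff-+P; coeff-·P; coeff-·P+P; coeff-∷*P-zero; coeff-∷*P-suc)

-- _≈P_ unfolds to a function type from which Agda cannot recover the polynomials; the
-- record keeps them visible to unification and to the ring solver.
infix 4 _≋_
record _≋_ (p q : Poly) : Set where
  constructor mk≋
  field coeffs-≡ : p ≈P q
open _≋_ public

ℤ[x] : CommutativeRing 0ℓ 0ℓ
ℤ[x] = record
  { Carrier = Poly ; _≈_ = _≋_ ; _+_ = _+P_ ; _*_ = _*P_ ; -_ = negP ; 0# = [] ; 1# = 1P
  ; isCommutativeRing = record
    { isRing = record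
      { +-isAbelianGroup = record
        { isGroup = record
          { isMonoid = record
            { isSemigroup = record
              { isMagma = record
                { isEquivalence = record
                  { refl  = mk≋ (λ _ → refl)
                  ; sym   = λ (mk≋ p≈q) → mk≋ (λ k → sym (p≈q k))
                  ; trans = λ (mk≋ p≈q) (mk≋ q≈r) → mk≋ (λ k → trans (p≈q k) (q≈r k))
                  }
                ; ∙-cong = λ {p} {p′} {q} {q′} (mk≋ p≈p′) (mk≋ q≈q′) →
                             mk≋ (Pointwise.+P-cong p p′ q q′ p≈p′ q≈q′)
                }
              ; assoc = λ p q r → mk≋ (Pointwise.+P-assoc p q r)
              }
            ; identity = (λ p → mk≋ (λ _ → refl)) , (λ p → mk≋ (Pointwise.+P-identityʳ p))
            }
          ; inverse = (λ p → mk≋ (Pointwise.+P-inverseˡ p))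
                    , (λ p → mk≋ (λ k → trans (Pointwise.+P-comm p (negP p) k) (Pointwise.+P-inverseˡ p k)))
          ; ⁻¹-cong = λ {p} {p′} (mk≋ p≈p′) → mk≋ (Pointwise.·P-congʳ -[1+ 0 ] p p′ p≈p′)
          }
        ; comm = λ p q → mk≋ (Pointwise.+P-comm p q)
        }
      ; *-cong = λ {p} {p′} {q} {q′} (mk≋ p≈p′) (mk≋ q≈q′) → mk≋ λ k →
                   trans (Pointwise.*P-congʳ p q q′ q≈q′ k)
                         (trans (Pointwise.*P-comm p q′ k)
                                (trans (Pointwise.*P-congʳ q′ p p′ p≈p′ k) (Pointwise.*P-comm q′ p′ k)))
      ; *-assoc = λ p q r → mk≋ (Pointwise.*P-assoc p q r)
      ; *-identity = (λ p → mk≋ (Pointwise.*P-identityˡ p))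
                   , (λ p → mk≋ (λ k → trans (Pointwise.*P-comm p 1P k) (Pointwise.*P-identityˡ p k)))
      ; distrib = (λ p q r → mk≋ (λ k → trans (Pointwise.*P-comm p (q +P r) k)
                                  (trans (Pointwise.*P-distribʳ q r p k)
                                         (Pointwise.+P-cong (q *P p) (p *P q) (r *P p) (p *P r)
                                                            (Pointwise.*P-comm q p) (Pointwise.*P-comm r p) k))))
                , (λ p q r → mk≋ (Pointwise.*P-distribʳ q r p))
      }
    ; *-comm = λ p q → mk≋ (Pointwise.*P-comm p q)
    }
  }

module ℤx = CommutativeRing ℤ[x]

open import Algebra.Properties.Semiring.Divisibility ℤx.semiring
  using (_∣_; _,_; ∣ʳ-refl; ∣ʳ-trans; ∣ʳ-respʳ-≈; ∣ʳ-respˡ-≈; x∣ʳy⇒x∣ʳzy; x∣ʳyx; _∣0; 0∣x⇒x≈0)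
open import Algebra.Properties.Semiring.Primality ℤx.semiring
  using (Coprime; Coprime-sym; ∣1⇒Coprime)
open import Algebra.Properties.Group ℤx.+-group using (\\-leftDividesʳ)
module ≋-Reasoning = SetoidReasoning ℤx.setoid

-- With no zero test the solver cannot cancel x against negP x; such steps use \\-leftDividesʳ.
ring : ACR.AlmostCommutativeRing 0ℓ 0ℓ
ring = ACR.fromCommutativeRing ℤ[x] (λ _ → nothing)

·P-cong : ∀ c {p q} → p ≋ q → c ·P p ≋ c ·P q
·P-cong c {p} {q} (mk≋ p≈q) = mk≋ (Pointwise.·P-congʳ c p q p≈q)

·P≈const*P : ∀ c p → c ·P p ≋ const c *P p
·P≈const*P c p = mk≋ λ k →
  sym (trans (Pointwise.+P-cong (c ·P p) (c ·P p) (shift []) [] (λ _ → refl) Pointwise.shift-[] k)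
             (Pointwise.+P-identityʳ (c ·P p) k))

·P-identityˡ : ∀ p → + 1 ·P p ≋ p
·P-identityˡ p = mk≋ λ k → trans (coeff-·P (+ 1) p k) (ℤ.*-identityˡ (coeff p k))

·P-+P : ∀ c p q → c ·P (p +P q) ≋ c ·P p +P c ·P q
·P-+P c p q = begin
  c ·P (p +P q)                 ≈⟨ ·P≈const*P c (p +P q) ⟩
  const c *P (p +P q)           ≈⟨ ℤx.distribˡ (const c) p q ⟩
  const c *P p +P const c *P q  ≈⟨ ℤx.+-cong (·P≈const*P c p) (·P≈const*P c q) ⟨
  c ·P p +P c ·P q              ∎
  where open ≋-Reasoning

·P-*P : ∀ c p q → (c ·P p) *P q ≋ c ·P (p *P q)
·P-*P c p q = mk≋ (Pointwise.·P-*P c p q)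

*P-·P : ∀ c p q → p *P (c ·P q) ≋ c ·P (p *P q)
*P-·P c p q = ℤx.trans (ℤx.*-comm p (c ·P q)) (ℤx.trans (·P-*P c q p) (·P-cong c (ℤx.*-comm q p)))

·P-·P : ∀ a b p → a ·P (b ·P p) ≋ (a ℤ.* b) ·P p
·P-·P a b p = mk≋ (Pointwise.·P-·P a b p)

·P-cancel : ∀ c {p q} → c ≢ + 0 → c ·P p ≋ c ·P q → p ≋ q
·P-cancel c {p} {q} c≢0 (mk≋ cp≈cq) = mk≋ (Pointwise.·P-cancelˡ c p q c≢0 cp≈cq)

∣-+P : ∀ {e a b} → e ∣ a → e ∣ b → e ∣ a +P b
∣-+P {e} (s , se≈a) (t , te≈b) = s +P t , ℤx.trans (ℤx.distribʳ e s t) (ℤx.+-cong se≈a te≈b)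

∣-*Pʳ : ∀ {e a} c → e ∣ a → e ∣ a *P c
∣-*Pʳ {a = a} c e∣a = ∣ʳ-respʳ-≈ (ℤx.*-comm c a) (x∣ʳy⇒x∣ʳzy c e∣a)

∣-·P : ∀ {e a} c → e ∣ a → e ∣ c ·P a
∣-·P {a = a} c e∣a = ∣ʳ-respʳ-≈ (ℤx.sym (·P≈const*P c a)) (x∣ʳy⇒x∣ʳzy (const c) e∣a)

∣a+b∣a⇒∣b : ∀ {e a b} → e ∣ a +P b → e ∣ a → e ∣ b
∣a+b∣a⇒∣b {a = a} {b} e∣a+b e∣a = ∣ʳ-respʳ-≈ (\\-leftDividesʳ a b) (∣-+P (∣-·P -[1+ 0 ] e∣a) e∣a+b)

∣a+b∣b⇒∣a : ∀ {e a b} → e ∣ a +P b → e ∣ b → e ∣ a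
∣a+b∣b⇒∣a {a = a} {b} e∣a+b = ∣a+b∣a⇒∣b (∣ʳ-respʳ-≈ (ℤx.+-comm a b) e∣a+b)

∣-·P-cong : ∀ {e a} c → e ∣ a → c ·P e ∣ c ·P a
∣-·P-cong {e} c (s , se≈a) = s , ℤx.trans (*P-·P c s e) (·P-cong c se≈a)

∣-·P-cancel : ∀ {c e a} → c ≢ + 0 → c ·P e ∣ c ·P a → e ∣ a
∣-·P-cancel {c} {e} c≢0 (s , s[ce]≈ca) = s , ·P-cancel c c≢0 (ℤx.trans (ℤx.sym (*P-·P c s e)) s[ce]≈ca)

∣-cancel-scalar-of-zero : ∀ {c e a} → e ≋ [] → c ≢ + 0 → e ∣ c ·P a → e ∣ a
∣-cancel-scalar-of-zero {c} {e} {a} e≈0 c≢0 e∣ca = ∣ʳ-respʳ-≈ (ℤx.sym a≈0) (e ∣0)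
  where
  a≈0 : a ≋ []
  a≈0 = ·P-cancel c c≢0 (0∣x⇒x≈0 (∣ʳ-respˡ-≈ e≈0 e∣ca))

-- Contents

infix 4 _∣ᶜ_
record _∣ᶜ_ (p : ℕ) (a : Poly) : Set where
  constructor mk∣ᶜ
  field ∣-coeff : ∀ k → + p ∣ℤ coeff a k
open _∣ᶜ_

module _ {p : ℕ} where
  open import Data.Integer using (_*_)

  ∣ᶜ-resp-≋ : ∀ {a b} → a ≋ b → p ∣ᶜ a → p ∣ᶜ b
  ∣ᶜ-resp-≋ (mk≋ a≈b) (mk∣ᶜ p∣a) = mk∣ᶜ λ k → subst (+ p ∣ℤ_) (a≈b k) (p∣a k)

  ∣ᶜ-∷ : ∀ {x a} → + p ∣ℤ x → p ∣ᶜ a → p ∣ᶜ (x ∷ a)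
  ∣ᶜ-∷ p∣x p∣a = mk∣ᶜ λ where
    zero    → p∣x
    (suc k) → ∣-coeff p∣a k

  ∣ᶜ-tail : ∀ {x a} → p ∣ᶜ (x ∷ a) → p ∣ᶜ a
  ∣ᶜ-tail p∣xa = mk∣ᶜ λ k → ∣-coeff p∣xa (suc k)

  ∣ℤ0 : + p ∣ℤ + 0
  ∣ℤ0 = divides (+ 0) (sym (ℤ.*-zeroˡ (+ p)))

  ∣ᶜ-[] : p ∣ᶜ []
  ∣ᶜ-[] = mk∣ᶜ λ _ → ∣ℤ0

  ∣ᶜ? : ∀ a → Dec (p ∣ᶜ a)
  ∣ᶜ? []      = yes ∣ᶜ-[]
  ∣ᶜ? (x ∷ a) with + p ℤ∣.∣? x | ∣ᶜ? a
  ... | yes p∣x | yes p∣a = yes (∣ᶜ-∷ p∣x p∣a)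
  ... | no  p∤x | _       = no λ p∣xa → p∤x (∣-coeff p∣xa zero)
  ... | yes _   | no  p∤a = no λ p∣xa → p∤a (∣ᶜ-tail p∣xa)

  ∣ᶜ-+P : ∀ {a b} → p ∣ᶜ a → p ∣ᶜ b → p ∣ᶜ a +P b
  ∣ᶜ-+P {a} {b} p∣a p∣b = mk∣ᶜ λ k →
    subst (+ p ∣ℤ_) (sym (coeff-+P a b k)) (ℤ∣.∣m∣n⇒∣m+n (∣-coeff p∣a k) (∣-coeff p∣b k))

  ∣ᶜ-+P-cancelˡ : ∀ {a b} → p ∣ᶜ a +P b → p ∣ᶜ a → p ∣ᶜ b
  ∣ᶜ-+P-cancelˡ {a} {b} p∣a+b p∣a = mk∣ᶜ λ k →
    ℤ∣.∣m+n∣m⇒∣n (subst (+ p ∣ℤ_) (coeff-+P a b k) (∣-coeff p∣a+b k)) (∣-coeff p∣a k)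

  ∣ᶜ-·Pˡ : ∀ {c} a → + p ∣ℤ c → p ∣ᶜ c ·P a
  ∣ᶜ-·Pˡ {c} a p∣c = mk∣ᶜ λ k →
    subst (+ p ∣ℤ_) (sym (coeff-·P c a k)) (ℤ∣.∣m⇒∣m*n (coeff a k) p∣c)

  ∣ᶜ-·Pʳ : ∀ c {a} → p ∣ᶜ a → p ∣ᶜ c ·P a
  ∣ᶜ-·Pʳ c {a} p∣a = mk∣ᶜ λ k →
    subst (+ p ∣ℤ_) (sym (coeff-·P c a k)) (ℤ∣.∣n⇒∣m*n c (∣-coeff p∣a k))

  ∣ᶜ-*Pˡ : ∀ b {a} → p ∣ᶜ a → p ∣ᶜ b *P a
  ∣ᶜ-*Pˡ []       p∣a = ∣ᶜ-[]
  ∣ᶜ-*Pˡ (x ∷ b)  p∣a = ∣ᶜ-+P (∣ᶜ-·Pʳ x p∣a) (∣ᶜ-∷ ∣ℤ0 (∣ᶜ-*Pˡ b p∣a))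

  ∣ᶜ⇒quotient : ∀ {a} → p ∣ᶜ a → Σ[ a′ ∈ Poly ] (∀ k → coeff a k ≡ coeff a′ k * + p)
  ∣ᶜ⇒quotient {[]}    p∣a = [] , λ _ → sym (ℤ.*-zeroˡ (+ p))
  ∣ᶜ⇒quotient {x ∷ a} p∣a with ∣-coeff p∣a zero | ∣ᶜ⇒quotient (∣ᶜ-tail p∣a)
  ... | divides x′ x≡x′p | a′ , a≡a′p = x′ ∷ a′ , λ where
    zero    → x≡x′p
    (suc k) → a≡a′p k

  ·P-quotient : ∀ a a′ → (∀ k → coeff a k ≡ coeff a′ k * + p) → a ≋ + p ·P a′
  ·P-quotient a a′ a≡a′p = mk≋ λ k →
    trans (a≡a′p k) (trans (ℤ.*-comm (coeff a′ k) (+ p)) (sym (coeff-·P (+ p) a′ k)))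

const∣⇒∣ᶜ : ∀ {p a} → const (+ p) ∣ a → p ∣ᶜ a
const∣⇒∣ᶜ (s , s*p≈a) = ∣ᶜ-resp-≋ s*p≈a (∣ᶜ-*Pˡ s (∣ᶜ-∷ ℤ∣.∣-refl ∣ᶜ-[]))

∣ᶜ⇒const∣ : ∀ {p a} → p ∣ᶜ a → const (+ p) ∣ a
∣ᶜ⇒const∣ {p} {a} p∣a with ∣ᶜ⇒quotient p∣a
... | a′ , a≡a′p = a′ , ℤx.trans (ℤx.*-comm a′ (const (+ p)))
                             (ℤx.trans (ℤx.sym (·P≈const*P (+ p) a′)) (ℤx.sym (·P-quotient a a′ a≡a′p)))

∣-abs⇒const∣ : ∀ {p k} → p ∣ℕ ∣ k ∣ → const (+ p) ∣ const k
∣-abs⇒const∣ p∣k = ∣ᶜ⇒const∣ (∣ᶜ-∷ (ℤ∣.∣ᵤ⇒∣ p∣k) ∣ᶜ-[])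

prime∤1P : ∀ {p} → Prime p → ¬ const (+ p) ∣ 1P
prime∤1P {p} p-prime p∣1 = ℕ.<⇒≢ (ℕ.nonTrivial⇒n>1 p {{prime⇒nonTrivial p-prime}})
                                   (sym (ℕ∣.∣1⇒≡1 (ℤ∣.∣⇒∣ᵤ (∣-coeff (const∣⇒∣ᶜ p∣1) 0))))

coprime⇒¬common-prime : ∀ {a b p} → Coprime a b → Prime p → ¬ (p ∣ᶜ a × p ∣ᶜ b)
coprime⇒¬common-prime coprime p-prime (p∣a , p∣b) = prime∤1P p-prime (coprime (∣ᶜ⇒const∣ p∣a) (∣ᶜ⇒const∣ p∣b))

-- Degrees

*-≢0 : ∀ {i j} → i ≢ + 0 → j ≢ + 0 → i ℤ.* j ≢ + 0
*-≢0 {i} i≢0 j≢0 ij≡0 = [ i≢0 , j≢0 ]′ (ℤ.i*j≡0⇒i≡0∨j≡0 i ij≡0)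

-- Coefficient lists may carry trailing zeros, so the degree is a relation, not a function.
VanishFrom : ℕ → Poly → Set
VanishFrom N p = ∀ j → N ℕ.≤ j → coeff p j ≡ + 0

record HasDegree (p : Poly) (n : ℕ) : Set where
  constructor has-degree
  field
    leading≢0 : coeff p n ≢ + 0
    vanishes  : VanishFrom (suc n) p
open HasDegree

vanishFrom-length : ∀ p → VanishFrom (length p) p
vanishFrom-length []      j       _         = refl
vanishFrom-length (x ∷ p) (suc j) (s≤s len≤j) = vanishFrom-length p j len≤j

zero-or-degree< : ∀ N p → VanishFrom N p → p ≋ [] ⊎ ∃[ n ] n ℕ.< N × HasDegree p n
zero-or-degree< zero    p p≈0 = inj₁ (mk≋ λ k → p≈0 k z≤n)
zero-or-degree< (suc N) p vanish with coeff p N ℤ.≟ + 0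
... | no  pₙ≢0 = inj₂ (N , ℕ.≤-refl , has-degree pₙ≢0 vanish)
... | yes pₙ≡0 with zero-or-degree< N p vanish′
  where
  vanish′ : VanishFrom N p
  vanish′ j N≤j with ℕ.m≤n⇒m<n∨m≡n N≤j
  ... | inj₁ N<j  = vanish j N<j
  ... | inj₂ refl = pₙ≡0
...   | inj₁ p≈0           = inj₁ p≈0
...   | inj₂ (n , n<N , d) = inj₂ (n , ℕ.m<n⇒m<1+n n<N , d)

zero-or-degree : ∀ p → p ≋ [] ⊎ ∃[ n ] HasDegree p n
zero-or-degree p with zero-or-degree< (length p) p (vanishFrom-length p)
... | inj₁ p≈0           = inj₁ p≈0
... | inj₂ (n , _ , deg) = inj₂ (n , deg)

module _ where
  open import Data.Integer using (_+_; _*_)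

  *P-leading : ∀ p q m n → VanishFrom (suc m) p → VanishFrom (suc n) q →
               coeff (p *P q) (m ℕ.+ n) ≡ coeff p m * coeff q n × VanishFrom (suc (m ℕ.+ n)) (p *P q)
  *P-leading []      q m       n _ _ = sym (ℤ.*-zeroˡ (coeff q n)) , λ _ _ → refl
  *P-leading (a ∷ p) q zero    n vp vq = leading , vanish
    where
    shift-pq≈0 : ∀ j → coeff (shift (p *P q)) j ≡ + 0
    shift-pq≈0 zero    = refl
    shift-pq≈0 (suc j) = coeffs-≡ (ℤx.trans (ℤx.*-congʳ {q} {p} {[]} (mk≋ λ k → vp (suc k) (s≤s z≤n))) (ℤx.zeroˡ q)) j
    leading : coeff ((a ∷ p) *P q) n ≡ a * coeff q n
    leading = trans (coeff-·P+P a q (shift (p *P q)) n)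
                    (trans (cong (λ z → a * coeff q n + z) (shift-pq≈0 n)) (ℤ.+-identityʳ _))
    vanish : VanishFrom (suc n) ((a ∷ p) *P q)
    vanish j n<j = trans (coeff-·P+P a q (shift (p *P q)) j)
                         (cong₂ _+_ (trans (cong (a *_) (vq j n<j)) (ℤ.*-zeroʳ a)) (shift-pq≈0 j))
  *P-leading (a ∷ p) q (suc m) n vp vq = leading , vanish
    where
    ih = *P-leading p q m n (λ j m<j → vp (suc j) (s≤s m<j)) vq
    a*qⱼ≡0 : ∀ j → suc n ℕ.≤ j → a * coeff q j ≡ + 0
    a*qⱼ≡0 j n<j = trans (cong (a *_) (vq j n<j)) (ℤ.*-zeroʳ a)
    leading : coeff ((a ∷ p) *P q) (suc (m ℕ.+ n)) ≡ coeff p m * coeff q n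
    leading = trans (coeff-∷*P-suc a p q (m ℕ.+ n))
                    (trans (cong₂ _+_ (a*qⱼ≡0 _ (s≤s (ℕ.m≤n+m n m))) (proj₁ ih)) (ℤ.+-identityˡ _))
    vanish : VanishFrom (suc (suc (m ℕ.+ n))) ((a ∷ p) *P q)
    vanish (suc j) (s≤s m+n<j) = trans (coeff-∷*P-suc a p q j)
      (cong₂ _+_ (a*qⱼ≡0 (suc j) (s≤s (ℕ.≤-trans (ℕ.m≤n+m n m) (ℕ.<⇒≤ m+n<j)))) (proj₂ ih j m+n<j))

  HasDegree-*P : ∀ {p q m n} → HasDegree p m → HasDegree q n → HasDegree (p *P q) (m ℕ.+ n)
  HasDegree-*P {p} {q} {m} {n} (has-degree pₘ≢0 vp) (has-degree qₙ≢0 vq) with *P-leading p q m n vp vq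
  ... | leading , vanish =
    has-degree (λ ≡0 → *-≢0 pₘ≢0 qₙ≢0 (trans (sym leading) ≡0)) vanish

∣1⇒degree0 : ∀ {e n} → HasDegree e n → e ∣ 1P → n ≡ 0
∣1⇒degree0 {n = zero}  _     _          = refl
∣1⇒degree0 {n = suc n} deg-e (s , se≈1) with zero-or-degree s
... | inj₁ s≈0 = ⊥-elim (1≢0 (trans (sym (coeffs-≡ se≈1 0)) (coeffs-≡ (ℤx.*-congʳ s≈0) 0)))
  where
  1≢0 : + 1 ≢ + 0
  1≢0 ()
... | inj₂ (m , deg-s) = ⊥-elim (leading≢0 (HasDegree-*P deg-s deg-e)
                                       (trans (coeffs-≡ se≈1 (m ℕ.+ suc n)) (cong (coeff 1P) (ℕ.+-suc m n))))

-- Gauss's lemma and cancellation of integer factors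

prime-∣ℤ-* : ∀ {p} x y → Prime p → + p ∣ℤ x ℤ.* y → + p ∣ℤ x ⊎ + p ∣ℤ y
prime-∣ℤ-* {p} x y p-prime p∣xy
  with euclidsLemma ∣ x ∣ ∣ y ∣ p-prime (subst (p ℕ∣.∣_) (ℤ.abs-* x y) (ℤ∣.∣⇒∣ᵤ p∣xy))
... | inj₁ p∣x = inj₁ (ℤ∣.∣ᵤ⇒∣ p∣x)
... | inj₂ p∣y = inj₂ (ℤ∣.∣ᵤ⇒∣ p∣y)

prime≢0 : ∀ {p} → Prime p → + p ≢ + 0
prime≢0 {p} p-prime refl = ℕ.<⇒≱ (ℕ.nonTrivial⇒n>1 0 {{prime⇒nonTrivial p-prime}}) z≤n

module _ {p : ℕ} (p-prime : Prime p) where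

  gauss-lemma-∷ : ∀ a₀ a b → ¬ + p ∣ℤ a₀ → p ∣ᶜ (a₀ ∷ a) *P b → p ∣ᶜ b
  gauss-lemma-∷ a₀ a []       p∤a₀ _    = ∣ᶜ-[]
  gauss-lemma-∷ a₀ a (b₀ ∷ b) p∤a₀ p∣ab
    with prime-∣ℤ-* a₀ b₀ p-prime (subst (+ p ∣ℤ_) (coeff-∷*P-zero a₀ a (b₀ ∷ b)) (∣-coeff p∣ab zero))
  ... | inj₁ p∣a₀ = ⊥-elim (p∤a₀ p∣a₀)
  ... | inj₂ p∣b₀ = ∣ᶜ-∷ p∣b₀ (gauss-lemma-∷ a₀ a b p∤a₀ p∣ab′)
    where
    p∣ab′ : p ∣ᶜ (a₀ ∷ a) *P b
    p∣ab′ = ∣ᶜ-tail (∣ᶜ-+P-cancelˡ (∣ᶜ-resp-≋ (mk≋ (Pointwise.*P-∷ʳ (a₀ ∷ a) b₀ b)) p∣ab)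
                                   (∣ᶜ-·Pˡ (a₀ ∷ a) p∣b₀))

  gauss-lemma : ∀ a b → p ∣ᶜ a *P b → p ∣ᶜ a ⊎ p ∣ᶜ b
  gauss-lemma []       b _    = inj₁ ∣ᶜ-[]
  gauss-lemma (a₀ ∷ a) b p∣ab with + p ℤ∣.∣? a₀
  ... | no  p∤a₀ = inj₂ (gauss-lemma-∷ a₀ a b p∤a₀ p∣ab)
  ... | yes p∣a₀ with gauss-lemma a b (∣ᶜ-tail (∣ᶜ-+P-cancelˡ p∣ab (∣ᶜ-·Pˡ b p∣a₀)))
  ...   | inj₁ p∣a = inj₁ (∣ᶜ-∷ p∣a₀ p∣a)
  ...   | inj₂ p∣b = inj₂ p∣b

  private
    p≢0 : + p ≢ + 0
    p≢0 = prime≢0 p-prime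

  ∣-cancel-prime-∤ᶜ : ∀ {e a} → ¬ p ∣ᶜ e → e ∣ + p ·P a → e ∣ a
  ∣-cancel-prime-∤ᶜ {e} {a} p∤e (s , se≈pa)
    with gauss-lemma s e (∣ᶜ-resp-≋ (ℤx.sym se≈pa) (∣ᶜ-·Pˡ a ℤ∣.∣-refl))
  ... | inj₂ p∣e = ⊥-elim (p∤e p∣e)
  ... | inj₁ p∣s with ∣ᶜ⇒quotient p∣s
  ...   | s′ , s≡s′p = s′ , ·P-cancel (+ p) p≢0 (begin
    + p ·P (s′ *P e)  ≈⟨ ·P-*P (+ p) s′ e ⟨
    (+ p ·P s′) *P e  ≈⟨ ℤx.*-congʳ (·P-quotient s s′ s≡s′p) ⟨
    s *P e            ≈⟨ se≈pa ⟩
    + p ·P a          ∎)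
    where open ≋-Reasoning

  quotient-smaller : ∀ {x y} → x ≡ y ℤ.* + p → x ≢ + 0 → y ≢ + 0 × ∣ y ∣ ℕ.< ∣ x ∣
  quotient-smaller {x} {y} x≡yp x≢0 = y≢0 , subst (∣ y ∣ ℕ.<_) (sym ∣x∣≡∣y∣p)
    (ℕ.m<m*n ∣ y ∣ p {{ℕ.≢-nonZero (y≢0 ∘ ℤ.∣i∣≡0⇒i≡0)}} (ℕ.nonTrivial⇒n>1 p {{prime⇒nonTrivial p-prime}}))
    where
    y≢0 : y ≢ + 0
    y≢0 refl = x≢0 (trans x≡yp (ℤ.*-zeroˡ (+ p)))
    ∣x∣≡∣y∣p : ∣ x ∣ ≡ ∣ y ∣ ℕ.* p
    ∣x∣≡∣y∣p = trans (cong ∣_∣ x≡yp) (ℤ.abs-* y (+ p))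

  module _ {Y} (p∤Y : ¬ p ∣ᶜ Y) where

    ∣ᶜ-transfer : ∀ {e a} → p ∣ᶜ e → e ∣ Y *P a → p ∣ᶜ a
    ∣ᶜ-transfer {e} {a} p∣e (t , te≈Ya) with gauss-lemma Y a (∣ᶜ-resp-≋ te≈Ya (∣ᶜ-*Pˡ t p∣e))
    ... | inj₁ p∣Y = ⊥-elim (p∤Y p∣Y)
    ... | inj₂ p∣a = p∣a

    -- If p divides the content of e, it divides that of a (Gauss, as p ∤ᶜ Y); dividing both
    -- by p shrinks the fixed non-zero coefficient eᵢ.
    ∣-cancel-prime-descent : ∀ i {e a} → coeff e i ≢ + 0 → Acc ℕ._<_ ∣ coeff e i ∣ →
                             e ∣ + p ·P a → e ∣ Y *P a → e ∣ a
    ∣-cancel-prime-descent i {e} {a} eᵢ≢0 (acc smaller) e∣pa e∣Ya with ∣ᶜ? e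
    ... | no  p∤e = ∣-cancel-prime-∤ᶜ p∤e e∣pa
    ... | yes p∣e with ∣ᶜ⇒quotient p∣e | ∣ᶜ⇒quotient (∣ᶜ-transfer p∣e e∣Ya)
    ... | e′ , e≡e′p | a′ , a≡a′p =
      ∣ʳ-respˡ-≈ (ℤx.sym e≈pe′) (∣ʳ-respʳ-≈ (ℤx.sym a≈pa′) (∣-·P-cong (+ p) e′∣a′))
      where
      e≈pe′ = ·P-quotient e e′ e≡e′p
      a≈pa′ = ·P-quotient a a′ a≡a′p
      e′∣pa′ : e′ ∣ + p ·P a′
      e′∣pa′ = ∣-·P-cancel p≢0 (∣ʳ-respˡ-≈ e≈pe′ (∣ʳ-respʳ-≈ (·P-cong (+ p) a≈pa′) e∣pa))
      e′∣Ya′ : e′ ∣ Y *P a′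
      e′∣Ya′ = ∣-·P-cancel p≢0
        (∣ʳ-respˡ-≈ e≈pe′ (∣ʳ-respʳ-≈ (ℤx.trans (ℤx.*-congˡ {Y} a≈pa′) (*P-·P (+ p) Y a′)) e∣Ya))
      e′∣a′ : e′ ∣ a′
      e′∣a′ with quotient-smaller (e≡e′p i) eᵢ≢0
      ... | e′ᵢ≢0 , smaller-i = ∣-cancel-prime-descent i e′ᵢ≢0 (smaller smaller-i) e′∣pa′ e′∣Ya′

    ∣-cancel-prime-∤ᶜY : ∀ {e a} → e ∣ + p ·P a → e ∣ Y *P a → e ∣ a
    ∣-cancel-prime-∤ᶜY {e} e∣pa e∣Ya with zero-or-degree e
    ... | inj₁ e≈0       = ∣-cancel-scalar-of-zero e≈0 p≢0 e∣pa
    ... | inj₂ (n , deg) = ∣-cancel-prime-descent n (leading≢0 deg) (<-wellFounded _) e∣pa e∣Ya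

  ∣-cancel-prime : ∀ {Y e a} → ¬ (p ∣ᶜ e × p ∣ᶜ Y) → e ∣ + p ·P a → e ∣ Y *P a → e ∣ a
  ∣-cancel-prime {Y} p∤e∨p∤Y e∣pa e∣Ya with ∣ᶜ? Y
  ... | no  p∤Y = ∣-cancel-prime-∤ᶜY p∤Y e∣pa e∣Ya
  ... | yes p∣Y = ∣-cancel-prime-∤ᶜ (λ p∣e → p∤e∨p∤Y (p∣e , p∣Y)) e∣pa

·P-product-∷ : ∀ p ps x → + product (p ∷ ps) ·P x ≋ + p ·P (+ product ps ·P x)
·P-product-∷ p ps x =
  ℤx.trans (ℤx.reflexive (cong (_·P x) (ℤ.pos-* p (product ps)))) (ℤx.sym (·P-·P (+ p) (+ product ps) x))

∣-cancel-product : ∀ {e Y A} ps → All Prime ps →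
                   (∀ {p} → Prime p → p ∣ℕ product ps → ¬ (p ∣ᶜ e × p ∣ᶜ Y)) →
                   e ∣ + product ps ·P A → e ∣ Y *P A → e ∣ A
∣-cancel-product {A = A} [] [] _ e∣A _ = ∣ʳ-respʳ-≈ (·P-identityˡ A) e∣A
∣-cancel-product {e} {Y} {A} (p ∷ ps) (p-prime ∷ ps-prime) coprime e∣pmA e∣YA =
  ∣-cancel-product ps ps-prime (λ q-prime q∣m → coprime q-prime (ℕ∣.∣-trans q∣m (ℕ∣.n∣m*n p)))
    (∣-cancel-prime p-prime (coprime p-prime (ℕ∣.m∣m*n m)) e∣p[mA] e∣Y[mA])
    e∣YA
  where
  m = product ps
  e∣p[mA] : e ∣ + p ·P (+ m ·P A)
  e∣p[mA] = ∣ʳ-respʳ-≈ (·P-product-∷ p ps A) e∣pmA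
  e∣Y[mA] : e ∣ Y *P (+ m ·P A)
  e∣Y[mA] = ∣ʳ-respʳ-≈ (ℤx.sym (*P-·P (+ m) Y A)) (∣-·P (+ m) e∣YA)

∣-abs-scale : ∀ k {e a} → e ∣ k ·P a → e ∣ + ∣ k ∣ ·P a
∣-abs-scale (+ n)               e∣ka = e∣ka
∣-abs-scale -[1+ n ]    {a = a} e∣ka = ∣ʳ-respʳ-≈ -1·k·a≈∣k∣·a (∣-·P -[1+ 0 ] e∣ka)
  where
  -1·k·a≈∣k∣·a : -[1+ 0 ] ·P (-[1+ n ] ·P a) ≋ + suc n ·P a
  -1·k·a≈∣k∣·a = ℤx.trans (·P-·P -[1+ 0 ] -[1+ n ] a) (ℤx.reflexive (cong (_·P a) (ℤ.-1*i≡-i -[1+ n ])))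

abs-nonZero : ∀ {k} → k ≢ + 0 → ℕ.NonZero ∣ k ∣
abs-nonZero k≢0 = ℕ.≢-nonZero (k≢0 ∘ ℤ.∣i∣≡0⇒i≡0)

∣-cancel-scalar : ∀ {k e Y A} → k ≢ + 0 →
                  (∀ {p} → Prime p → p ∣ℕ ∣ k ∣ → ¬ (p ∣ᶜ e × p ∣ᶜ Y)) →
                  e ∣ k ·P A → e ∣ Y *P A → e ∣ A
∣-cancel-scalar {k} {A = A} k≢0 coprime e∣kA e∣YA with factorise ∣ k ∣ {{abs-nonZero k≢0}}
... | record { factors = ps ; isFactorisation = ∣k∣≡∏ps ; factorsPrime = ps-prime } =
  ∣-cancel-product ps ps-prime (λ p-prime p∣∏ → coprime p-prime (subst (_ ∣ℕ_) (sym ∣k∣≡∏ps) p∣∏))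
    (subst (λ n → _ ∣ + n ·P A) ∣k∣≡∏ps (∣-abs-scale k e∣kA)) e∣YA

-- Pseudo-division and Euclid's lemma

module _ where
  open import Data.Integer using (_+_; _*_; -_)

  xⁿ : ℕ → Poly
  xⁿ zero    = 1P
  xⁿ (suc j) = shift (xⁿ j)

  coeff-xⁿ*P : ∀ j b i → coeff (xⁿ j *P b) (j ℕ.+ i) ≡ coeff b i
  coeff-xⁿ*P zero    b i = Pointwise.*P-identityˡ b i
  coeff-xⁿ*P (suc j) b i = trans (Pointwise.shift-*P (xⁿ j) b (suc (j ℕ.+ i))) (coeff-xⁿ*P j b i)

  leading-term-elimination : ∀ a {b n N} → HasDegree b n → n ℕ.≤ N → VanishFrom (suc N) a →
    VanishFrom N (coeff b n ·P a +P (- coeff a N) ·P (xⁿ (N ℕ.∸ n) *P b))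
  leading-term-elimination a {b} {n} {N} (has-degree _ b-vanishes) n≤N a-vanishes i N≤i =
    trans (coeff-+P (l ·P a) ((- c) ·P S) i)
          (trans (cong₂ _+_ (coeff-·P l a i) (trans (coeff-·P (- c) S i) (cong ((- c) *_) Sᵢ≡bᵢ′)))
                 (cancels (ℕ.m≤n⇒m<n∨m≡n N≤i)))
    where
    l = coeff b n
    c = coeff a N
    j = N ℕ.∸ n
    S = xⁿ j *P b
    j+n≡N : j ℕ.+ n ≡ N
    j+n≡N = ℕ.m∸n+n≡m n≤N
    i′ = i ℕ.∸ j
    j+i′≡i : j ℕ.+ i′ ≡ i
    j+i′≡i = ℕ.m+[n∸m]≡n (ℕ.≤-trans (ℕ.m≤m+n j n) (subst (ℕ._≤ i) (sym j+n≡N) N≤i))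
    Sᵢ≡bᵢ′ : coeff S i ≡ coeff b i′
    Sᵢ≡bᵢ′ = subst (λ t → coeff S t ≡ coeff b i′) j+i′≡i (coeff-xⁿ*P j b i′)
    cancels : N ℕ.< i ⊎ N ≡ i → l * coeff a i + (- c) * coeff b i′ ≡ + 0
    cancels (inj₂ refl) = trans (cong (λ t → l * c + (- c) * coeff b t) i′≡n) (l*c-c*l≡0 l c)
      where
      i′≡n : i′ ≡ n
      i′≡n = trans (cong (ℕ._∸ j) (sym j+n≡N)) (ℕ.m+n∸m≡n j n)
      l*c-c*l≡0 : ∀ l c → l * c + (- c) * l ≡ + 0
      l*c-c*l≡0 = ℤ-Solver.solve-∀
    cancels (inj₁ N<i) = begin
      l * coeff a i + (- c) * coeff b i′ ≡⟨ cong₂ (λ x y → l * x + (- c) * y) (a-vanishes i N<i) (b-vanishes i′ n<i′) ⟩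
      l * + 0 + (- c) * + 0              ≡⟨ cong₂ _+_ (ℤ.*-zeroʳ l) (ℤ.*-zeroʳ (- c)) ⟩
      + 0                                ∎
      where
      open ≡-Reasoning
      n<i′ : n ℕ.< i′
      n<i′ = ℕ.+-cancelˡ-< j n i′ (subst₂ ℕ._<_ (sym j+n≡N) (sym j+i′≡i) N<i)

  record PseudoDivision (a b : Poly) (n : ℕ) : Set where
    constructor pseudo-division
    field
      scale              : ℤ
      scale≢0            : scale ≢ + 0
      quotient           : Poly
      remainder          : Poly
      equation           : scale ·P a ≋ quotient *P b +P remainder
      remainder-vanishes : VanishFrom n remainder

  pseudo-divide : ∀ N a {b n} → HasDegree b n → VanishFrom N a → PseudoDivision a b n
  pseudo-divide N a {b} {n} deg-b a-vanishes with N ℕ.≤? n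
  ... | yes N≤n = pseudo-division (+ 1) (λ ()) [] a (·P-identityˡ a) λ j n≤j → a-vanishes j (ℕ.≤-trans N≤n n≤j)
  pseudo-divide zero    a deg-b a-vanishes | no N≰n = ⊥-elim (N≰n z≤n)
  pseudo-divide (suc N) a {b} {n} deg-b a-vanishes | no N≰n
    with pseudo-divide N (coeff b n ·P a +P (- coeff a N) ·P (xⁿ (N ℕ.∸ n) *P b)) deg-b
           (leading-term-elimination a deg-b (ℕ.≤-pred (ℕ.≰⇒> N≰n)) a-vanishes)
  ... | pseudo-division L L≢0 q r eq r-vanishes =
    pseudo-division (L * l) (*-≢0 L≢0 (leading≢0 deg-b)) (q +P (L * c) ·P xⁿ j) r (mk≋ equation) r-vanishes
    where
    open ≡-Reasoning
    l = coeff b n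
    c = coeff a N
    j = N ℕ.∸ n
    S = xⁿ j *P b
    a′ = l ·P a +P (- c) ·P S
    regroup : ∀ L l A c S → (L * l) * A ≡ L * (l * A + (- c) * S) + (L * c) * S
    regroup = ℤ-Solver.solve-∀
    swap : ∀ x y z → x + y + z ≡ x + z + y
    swap = ℤ-Solver.solve-∀
    equation : ∀ k → coeff ((L * l) ·P a) k ≡ coeff ((q +P (L * c) ·P xⁿ j) *P b +P r) k
    equation k = begin
      coeff ((L * l) ·P a) k                         ≡⟨ coeff-·P (L * l) a k ⟩
      (L * l) * coeff a k                            ≡⟨ regroup L l (coeff a k) c (coeff S k) ⟩
      L * (l * coeff a k + (- c) * coeff S k) + (L * c) * coeff S k
        ≡⟨ cong (λ x → L * x + (L * c) * coeff S k)
                (sym (trans (coeff-+P (l ·P a) ((- c) ·P S) k) (cong₂ _+_ (coeff-·P l a k) (coeff-·P (- c) S k)))) ⟩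
      L * coeff a′ k + (L * c) * coeff S k           ≡⟨ cong (_+ (L * c) * coeff S k)
                                                            (trans (sym (coeff-·P L a′ k)) (coeffs-≡ eq k)) ⟩
      coeff (q *P b +P r) k + (L * c) * coeff S k    ≡⟨ cong (_+ (L * c) * coeff S k) (coeff-+P (q *P b) r k) ⟩
      coeff (q *P b) k + coeff r k + (L * c) * coeff S k
        ≡⟨ swap (coeff (q *P b) k) (coeff r k) ((L * c) * coeff S k) ⟩
      coeff (q *P b) k + (L * c) * coeff S k + coeff r k
        ≡⟨ cong (λ x → coeff (q *P b) k + x + coeff r k)
                (sym (trans (Pointwise.·P-*P (L * c) (xⁿ j) b k) (coeff-·P (L * c) S k))) ⟩
      coeff (q *P b) k + coeff (((L * c) ·P xⁿ j) *P b) k + coeff r k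
        ≡⟨ cong (_+ coeff r k) (sym (trans (Pointwise.*P-distribʳ q ((L * c) ·P xⁿ j) b k)
                                           (coeff-+P (q *P b) (((L * c) ·P xⁿ j) *P b) k))) ⟩
      coeff ((q +P (L * c) ·P xⁿ j) *P b) k + coeff r k ≡⟨ coeff-+P ((q +P (L * c) ·P xⁿ j) *P b) r k ⟨
      coeff ((q +P (L * c) ·P xⁿ j) *P b +P r) k     ∎

infix 4 _∈⟨_,_⟩
record _∈⟨_,_⟩ (h a b : Poly) : Set where
  constructor combination
  field
    left-factor right-factor : Poly
    equation : left-factor *P a +P right-factor *P b ≋ h

record PseudoGCD (a b : Poly) : Set where
  constructor pseudo-gcd
  field
    divisor          : Poly
    degree           : ℕ
    divisor-degree   : HasDegree divisor degree
    divisor-∈        : divisor ∈⟨ a , b ⟩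
    scale            : ℤ
    scale≢0          : scale ≢ + 0
    divides-scaled-a : divisor ∣ scale ·P a
    divides-scaled-b : divisor ∣ scale ·P b

pseudo-euclid : ∀ a {b n} → HasDegree b n → Acc ℕ._<_ n → PseudoGCD a b
pseudo-euclid a {b} {n} deg-b (acc smaller)
  with pseudo-divide (length a) a deg-b (vanishFrom-length a)
... | pseudo-division L L≢0 q r La≈qb+r r-vanishes with zero-or-degree< n r r-vanishes
...   | inj₁ r≈0 = pseudo-gcd b n deg-b (combination [] 1P (ℤx.*-identityˡ b)) L L≢0 b∣La (∣-·P L ∣ʳ-refl)
  where
  b∣La : b ∣ L ·P a
  b∣La = q , ℤx.sym (ℤx.trans La≈qb+r (ℤx.trans (ℤx.+-congˡ r≈0) (ℤx.+-identityʳ (q *P b))))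
...   | inj₂ (m , m<n , deg-r) with pseudo-euclid b deg-r (smaller m<n)
...     | pseudo-gcd h d deg-h (combination u v ub+vr≈h) l l≢0 h∣lb h∣lr =
  pseudo-gcd h d deg-h (combination (v *P const L) (u +P negP (v *P q)) ∈ab) (l ℤ.* L) (*-≢0 l≢0 L≢0) h∣lLa h∣lLb
  where
  open ≋-Reasoning
  substitute : ∀ u v q b L a →
    u *P b +P v *P (L *P a +P negP (q *P b)) ≋ v *P L *P a +P (u +P negP (v *P q)) *P b
  substitute = solve-∀ ring
  r≈La-qb : r ≋ const L *P a +P negP (q *P b)
  r≈La-qb = begin
    r                                   ≈⟨ \\-leftDividesʳ (q *P b) r ⟨
    negP (q *P b) +P (q *P b +P r)      ≈⟨ ℤx.+-comm (negP (q *P b)) (q *P b +P r) ⟩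
    (q *P b +P r) +P negP (q *P b)      ≈⟨ ℤx.+-congʳ La≈qb+r ⟨
    L ·P a +P negP (q *P b)             ≈⟨ ℤx.+-congʳ (·P≈const*P L a) ⟩
    const L *P a +P negP (q *P b)       ∎
  ∈ab : v *P const L *P a +P (u +P negP (v *P q)) *P b ≋ h
  ∈ab = begin
    v *P const L *P a +P (u +P negP (v *P q)) *P b   ≈⟨ substitute u v q b (const L) a ⟨
    u *P b +P v *P (const L *P a +P negP (q *P b))   ≈⟨ ℤx.+-congˡ {u *P b} (ℤx.*-congˡ {v} r≈La-qb) ⟨
    u *P b +P v *P r                                 ≈⟨ ub+vr≈h ⟩
    h                                                ∎
  h∣lLa : h ∣ (l ℤ.* L) ·P a
  h∣lLa = ∣ʳ-respʳ-≈ (begin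
    q *P (l ·P b) +P l ·P r ≈⟨ ℤx.+-congʳ (*P-·P l q b) ⟩
    l ·P (q *P b) +P l ·P r ≈⟨ ·P-+P l (q *P b) r ⟨
    l ·P (q *P b +P r)      ≈⟨ ·P-cong l La≈qb+r ⟨
    l ·P (L ·P a)           ≈⟨ ·P-·P l L a ⟩
    (l ℤ.* L) ·P a          ∎) (∣-+P (x∣ʳy⇒x∣ʳzy q h∣lb) h∣lr)
  h∣lLb : h ∣ (l ℤ.* L) ·P b
  h∣lLb = ∣ʳ-respʳ-≈ (ℤx.trans (·P-·P L l b) (ℤx.reflexive (cong (_·P b) (ℤ.*-comm L l)))) (∣-·P L h∣lb)

HasDegree-quotient : ∀ {h h′ d c} → c ≢ + 0 → (∀ k → coeff h k ≡ coeff h′ k ℤ.* c) → HasDegree h d → HasDegree h′ d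
HasDegree-quotient {h} {h′} {d} {c} c≢0 h≡h′c (has-degree h-lead≢0 h-vanishes) =
  has-degree (λ h′-lead≡0 → h-lead≢0 (trans (h≡h′c d) (annihilate h′-lead≡0)))
             (λ j d<j → [ id , (λ c≡0 → ⊥-elim (c≢0 c≡0)) ]′
                          (ℤ.i*j≡0⇒i≡0∨j≡0 (coeff h′ j) (trans (sym (h≡h′c j)) (h-vanishes j d<j))))
  where
  annihilate : ∀ {x} → x ≡ + 0 → x ℤ.* c ≡ + 0
  annihilate refl = ℤ.*-zeroˡ c

common-divisor-of-scaled : ∀ {h d a b} ps → All Prime ps → HasDegree h d →
                           h ∣ + product ps ·P a → h ∣ + product ps ·P b →
                           Σ[ h′ ∈ Poly ] HasDegree h′ d × (h′ ∣ a) × (h′ ∣ b)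
common-divisor-of-scaled {h} {a = a} {b} [] [] deg-h h∣a h∣b =
  h , deg-h , ∣ʳ-respʳ-≈ (·P-identityˡ a) h∣a , ∣ʳ-respʳ-≈ (·P-identityˡ b) h∣b
common-divisor-of-scaled {h} {a = a} {b} (p ∷ ps) (p-prime ∷ ps-prime) deg-h h∣pma h∣pmb
  with ∣ᶜ? {p} h
... | no p∤h = common-divisor-of-scaled ps ps-prime deg-h
                 (∣-cancel-prime-∤ᶜ p-prime p∤h (split h∣pma)) (∣-cancel-prime-∤ᶜ p-prime p∤h (split h∣pmb))
  where
  split : ∀ {x} → h ∣ + product (p ∷ ps) ·P x → h ∣ + p ·P (+ product ps ·P x)
  split {x} = ∣ʳ-respʳ-≈ (·P-product-∷ p ps x)
... | yes p∣h with ∣ᶜ⇒quotient p∣h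
...   | h′ , h≡h′p = common-divisor-of-scaled ps ps-prime (HasDegree-quotient (prime≢0 p-prime) h≡h′p deg-h)
                       (divide h∣pma) (divide h∣pmb)
  where
  divide : ∀ {x} → h ∣ + product (p ∷ ps) ·P x → h′ ∣ + product ps ·P x
  divide {x} h∣pmx = ∣-·P-cancel (prime≢0 p-prime)
    (∣ʳ-respˡ-≈ (·P-quotient h h′ h≡h′p) (∣ʳ-respʳ-≈ (·P-product-∷ p ps x) h∣pmx))

common-divisor-of-scaled-ℤ : ∀ {h d a b k} → k ≢ + 0 → HasDegree h d → h ∣ k ·P a → h ∣ k ·P b →
                             Σ[ h′ ∈ Poly ] HasDegree h′ d × (h′ ∣ a) × (h′ ∣ b)
common-divisor-of-scaled-ℤ {a = a} {b} {k} k≢0 deg-h h∣ka h∣kb with factorise ∣ k ∣ {{abs-nonZero k≢0}}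
... | record { factors = ps ; isFactorisation = ∣k∣≡∏ps ; factorsPrime = ps-prime } =
  common-divisor-of-scaled ps ps-prime deg-h (rescale (∣-abs-scale k h∣ka)) (rescale (∣-abs-scale k h∣kb))
  where
  rescale : ∀ {h x} → h ∣ + ∣ k ∣ ·P x → h ∣ + product ps ·P x
  rescale {h} {x} = subst (λ n → h ∣ + n ·P x) ∣k∣≡∏ps

∈⟨⟩-resp-≋ : ∀ {h h′ a b} → h ≋ h′ → h ∈⟨ a , b ⟩ → h′ ∈⟨ a , b ⟩
∈⟨⟩-resp-≋ h≈h′ (combination u v ua+vb≈h) = combination u v (ℤx.trans ua+vb≈h h≈h′)

degree0⇒const : ∀ {h} → HasDegree h 0 → h ≋ const (coeff h 0)
degree0⇒const {h} deg-h = mk≋ λ where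
  zero    → refl
  (suc j) → vanishes deg-h (suc j) (s≤s z≤n)

coprime⇒const∈ : ∀ {a b} → Coprime a b → ∃[ k ] k ≢ + 0 × const k ∈⟨ a , b ⟩
coprime⇒const∈ {a} {b} coprime with zero-or-degree b
... | inj₁ b≈0 with coprime ∣ʳ-refl (∣ʳ-respʳ-≈ (ℤx.sym b≈0) (a ∣0))
...   | s , sa≈1 = + 1 , (λ ()) , combination s [] (ℤx.trans (ℤx.+-identityʳ (s *P a)) sa≈1)
coprime⇒const∈ {a} {b} coprime | inj₂ (n , deg-b) with pseudo-euclid a deg-b (<-wellFounded n)
... | pseudo-gcd h zero deg-h h∈ab _ _ _ _ =
  coeff h 0 , leading≢0 deg-h , ∈⟨⟩-resp-≋ (degree0⇒const deg-h) h∈ab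
... | pseudo-gcd h (suc d) deg-h _ l l≢0 h∣la h∣lb with common-divisor-of-scaled-ℤ l≢0 deg-h h∣la h∣lb
...   | h′ , deg-h′ , h′∣a , h′∣b = ⊥-elim (ℕ.1+n≢0 (∣1⇒degree0 deg-h′ (coprime h′∣a h′∣b)))

coprime-divisor : ∀ {a b c} → Coprime a b → a ∣ b *P c → a ∣ c
coprime-divisor {a} {b} {c} coprime a∣bc with coprime⇒const∈ coprime
... | k , k≢0 , combination u v ua+vb≈k =
  ∣-cancel-scalar k≢0 (λ p-prime _ → coprime⇒¬common-prime coprime p-prime) a∣kc a∣bc
  where
  open ≋-Reasoning
  regroup : ∀ u v a b c → (u *P c) *P a +P v *P (b *P c) ≋ (u *P a +P v *P b) *P c
  regroup = solve-∀ ring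
  a∣kc : a ∣ k ·P c
  a∣kc = ∣ʳ-respʳ-≈ (begin
    (u *P c) *P a +P v *P (b *P c) ≈⟨ regroup u v a b c ⟩
    (u *P a +P v *P b) *P c        ≈⟨ ℤx.*-congʳ ua+vb≈k ⟩
    const k *P c                   ≈⟨ ·P≈const*P k c ⟨
    k ·P c                         ∎) (∣-+P (x∣ʳyx a (u *P c)) (x∣ʳy⇒x∣ʳzy v a∣bc))

Coprime-∣ˡ : ∀ {a a′ b} → a′ ∣ a → Coprime a b → Coprime a′ b
Coprime-∣ˡ a′∣a coprime e∣a′ e∣b = coprime (∣ʳ-trans e∣a′ a′∣a) e∣b

Coprime-∣ʳ : ∀ {a b b′} → b′ ∣ b → Coprime a b → Coprime a b′
Coprime-∣ʳ b′∣b coprime = Coprime-sym (Coprime-∣ˡ b′∣b (Coprime-sym coprime))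

Coprime-*ʳ : ∀ {a b c} → Coprime a b → Coprime a c → Coprime a (b *P c)
Coprime-*ʳ a⊥b a⊥c e∣a e∣bc = a⊥c e∣a (coprime-divisor (Coprime-∣ˡ e∣a a⊥b) e∣bc)

-- Generalized Fibonacci polynomials

-- From here on _+_ is addition of indices; the ℤ operations were only opened locally above.
open import Data.Nat using (_+_; _∸_; _<_; _>_)
open import Algebra.Definitions.RawSemiring (Semiring.rawSemiring ℤx.semiring) using (_^_)

module GeneralizedFibonacci (d g : Poly) where

  G′ : ℕ → Poly
  G′ = Gprime d g

  G′-2 : G′ 2 ≋ d
  G′-2 = ℤx.trans (ℤx.+-cong (ℤx.*-identityʳ d) (ℤx.zeroʳ g)) (ℤx.+-identityʳ d)

  module _ (P₀ P₁ : Poly) where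

    private
      G : ℕ → Poly
      G = GFP P₀ P₁ d g

    GFP-addition : ∀ j r → G (suc j + r) ≋ G′ (suc j) *P G (suc r) +P g *P G′ j *P G r
    GFP-addition zero          r = ℤx.sym (ℤx.trans (ℤx.+-cong (ℤx.*-identityˡ (G (suc r)))
                                                      (ℤx.trans (ℤx.*-congʳ (ℤx.zeroʳ g)) (ℤx.zeroˡ (G r))))
                                           (ℤx.+-identityʳ (G (suc r))))
    GFP-addition (suc zero)    r = ℤx.+-cong (ℤx.*-congʳ (ℤx.sym G′-2)) (ℤx.*-congʳ (ℤx.sym (ℤx.*-identityʳ g)))
    GFP-addition (suc (suc j)) r = begin
      d *P G (suc (suc j) + r) +P g *P G (suc j + r)
        ≈⟨ ℤx.+-cong (ℤx.*-congˡ {d} (GFP-addition (suc j) r)) (ℤx.*-congˡ {g} (GFP-addition j r)) ⟩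
      d *P (G′ (suc (suc j)) *P G (suc r) +P g *P G′ (suc j) *P G r)
        +P g *P (G′ (suc j) *P G (suc r) +P g *P G′ j *P G r)
        ≈⟨ regroup d g (G′ j) (G′ (suc (suc j))) (G′ (suc j)) (G (suc r)) (G r) ⟩
      G′ (suc (suc (suc j))) *P G (suc r) +P g *P G′ (suc (suc j)) *P G r ∎
      where
      open ≋-Reasoning
      regroup : ∀ d g a b c x y →
        d *P (b *P x +P g *P c *P y) +P g *P (c *P x +P g *P a *P y)
          ≋ (d *P b +P g *P c) *P x +P g *P (d *P c +P g *P a) *P y
      regroup = solve-∀ ring

    GFP-mod-g : ∀ n → ∃[ w ] G (suc n) ≋ d ^ n *P G 1 +P g *P w
    GFP-mod-g zero    = [] , ℤx.sym (ℤx.trans (ℤx.+-cong (ℤx.*-identityˡ (G 1)) (ℤx.zeroʳ g)) (ℤx.+-identityʳ (G 1)))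
    GFP-mod-g (suc n) with GFP-mod-g n
    ... | w , G[1+n]≈dⁿG₁+gw = d *P w +P G n , (begin
      d *P G (suc n) +P g *P G n                  ≈⟨ ℤx.+-congʳ (ℤx.*-congˡ {d} G[1+n]≈dⁿG₁+gw) ⟩
      d *P (d ^ n *P G 1 +P g *P w) +P g *P G n   ≈⟨ regroup d g (d ^ n) (G 1) w (G n) ⟩
      d *P d ^ n *P G 1 +P g *P (d *P w +P G n)   ∎)
      where
      open ≋-Reasoning
      regroup : ∀ d g p h w x → d *P (p *P h +P g *P w) +P g *P x ≋ d *P p *P h +P g *P (d *P w +P x)
      regroup = solve-∀ ring

  ∣G′-consecutive⇒∣ : ∀ {e} k B → Coprime e g → e ∣ G′ k *P B → e ∣ G′ (suc k) *P B → e ∣ B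
  ∣G′-consecutive⇒∣ zero    B _   _        e∣G′₁B = ∣ʳ-respʳ-≈ (ℤx.*-identityˡ B) e∣G′₁B
  ∣G′-consecutive⇒∣ {e} (suc k) B e⊥g e∣G′₁₊ₖB e∣G′₂₊ₖB = ∣G′-consecutive⇒∣ k B e⊥g e∣G′ₖB e∣G′₁₊ₖB
    where
    e∣gG′ₖB : e ∣ g *P (G′ k *P B)
    e∣gG′ₖB = ∣ʳ-respʳ-≈ (ℤx.*-assoc g (G′ k) B)
      (∣a+b∣a⇒∣b (∣ʳ-respʳ-≈ (ℤx.distribʳ B (d *P G′ (suc k)) (g *P G′ k)) e∣G′₂₊ₖB)
                 (∣ʳ-respʳ-≈ (ℤx.sym (ℤx.*-assoc d (G′ (suc k)) B)) (x∣ʳy⇒x∣ʳzy d e∣G′₁₊ₖB)))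
    e∣G′ₖB : e ∣ G′ k *P B
    e∣G′ₖB = coprime-divisor e⊥g e∣gG′ₖB

two·P : ∀ p → + 2 ·P p ≋ p +P p
two·P p = mk≋ λ k → trans (coeff-·P (+ 2) p k) (trans (double (coeff p k)) (sym (coeff-+P p p k)))
  where
  double : ∀ x → + 2 ℤ.* x ≡ x ℤ.+ x
  double = ℤ-Solver.solve-∀

p₁∣d : ∀ p₀ {p₁ d} → ∣ p₀ ∣ ≡ 1 ⊎ ∣ p₀ ∣ ≡ 2 → + 2 ·P p₁ ≋ p₀ ·P d → p₁ ∣ d
p₁∣d (+ 1)     {p₁} {d} _ 2p₁≈d = const (+ 2) , (begin
  const (+ 2) *P p₁ ≈⟨ ·P≈const*P (+ 2) p₁ ⟨
  + 2 ·P p₁         ≈⟨ 2p₁≈d ⟩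
  + 1 ·P d          ≈⟨ ·P-identityˡ d ⟩
  d                 ∎)
  where open ≋-Reasoning
p₁∣d (+ 2)     {p₁} {d} _ 2p₁≈2d = 1P , ℤx.trans (ℤx.*-identityˡ p₁) (·P-cancel (+ 2) (λ ()) 2p₁≈2d)
p₁∣d -[1+ 0 ]  {p₁} {d} _ 2p₁≈-d = const -[1+ 1 ] , (begin
  const -[1+ 1 ] *P p₁     ≈⟨ ·P≈const*P -[1+ 1 ] p₁ ⟨
  -[1+ 1 ] ·P p₁           ≈⟨ ·P-·P -[1+ 0 ] (+ 2) p₁ ⟨
  -[1+ 0 ] ·P (+ 2 ·P p₁)  ≈⟨ ·P-cong -[1+ 0 ] 2p₁≈-d ⟩
  -[1+ 0 ] ·P (-[1+ 0 ] ·P d) ≈⟨ ·P-·P -[1+ 0 ] -[1+ 0 ] d ⟩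
  + 1 ·P d                 ≈⟨ ·P-identityˡ d ⟩
  d                        ∎)
  where open ≋-Reasoning
p₁∣d -[1+ 1 ]  {p₁} {d} _ 2p₁≈-2d = const -[1+ 0 ] , (begin
  const -[1+ 0 ] *P p₁        ≈⟨ ·P≈const*P -[1+ 0 ] p₁ ⟨
  -[1+ 0 ] ·P p₁              ≈⟨ ·P-cong -[1+ 0 ] p₁≈-d ⟩
  -[1+ 0 ] ·P (-[1+ 0 ] ·P d) ≈⟨ ·P-·P -[1+ 0 ] -[1+ 0 ] d ⟩
  + 1 ·P d                    ≈⟨ ·P-identityˡ d ⟩
  d                           ∎)
  where
  open ≋-Reasoning
  p₁≈-d : p₁ ≋ -[1+ 0 ] ·P d
  p₁≈-d = ·P-cancel (+ 2) (λ ()) (ℤx.trans 2p₁≈-2d (ℤx.sym (·P-·P (+ 2) -[1+ 0 ] d)))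
p₁∣d (+ 0)                 (inj₁ ()) _
p₁∣d (+ 0)                 (inj₂ ()) _
p₁∣d (+ suc (suc (suc _))) (inj₁ ()) _
p₁∣d (+ suc (suc (suc _))) (inj₂ ()) _
p₁∣d -[1+ suc (suc _) ]    (inj₁ ()) _
p₁∣d -[1+ suc (suc _) ]    (inj₂ ()) _

SameCommonDivisors : Poly → Poly → Poly → Set
SameCommonDivisors a b c = ∀ {e} → e ∣ c → (e ∣ a) ⇔ (e ∣ b)

module LucasSequence (p₀ : ℤ) (p₁ d g : Poly)
                 (2p₁≈p₀d : + 2 ·P p₁ ≋ p₀ ·P d) (∣p₀∣≤2 : ∣ p₀ ∣ ≡ 1 ⊎ ∣ p₀ ∣ ≡ 2)
                 (d⊥g : Coprime d g) (p₀⊥p₁ : Coprime (const p₀) p₁) where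

  open GeneralizedFibonacci d g

  G* : ℕ → Poly
  G* = Gstar p₀ p₁ d g

  lucas-fibonacci : ∀ n → const p₀ *P G′ (suc n) ≋ p₁ *P G′ n +P G* n
  lucas-fibonacci zero = begin
    const p₀ *P 1P        ≈⟨ ℤx.*-identityʳ (const p₀) ⟩
    const p₀              ≈⟨ ℤx.+-identityˡ (const p₀) ⟨
    [] +P const p₀        ≈⟨ ℤx.+-congʳ (ℤx.zeroʳ p₁) ⟨
    p₁ *P [] +P const p₀  ∎
    where open ≋-Reasoning
  lucas-fibonacci (suc zero) = begin
    const p₀ *P G′ 2       ≈⟨ ℤx.*-congˡ {const p₀} G′-2 ⟩
    const p₀ *P d         ≈⟨ ·P≈const*P p₀ d ⟨
    p₀ ·P d               ≈⟨ 2p₁≈p₀d ⟨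
    + 2 ·P p₁             ≈⟨ two·P p₁ ⟩
    p₁ +P p₁              ≈⟨ ℤx.+-congʳ (ℤx.*-identityʳ p₁) ⟨
    p₁ *P 1P +P p₁        ∎
    where open ≋-Reasoning
  lucas-fibonacci (suc (suc n)) = begin
    const p₀ *P (d *P G′ (suc (suc n)) +P g *P G′ (suc n))
      ≈⟨ distribute (const p₀) d g (G′ (suc (suc n))) (G′ (suc n)) ⟩
    d *P (const p₀ *P G′ (suc (suc n))) +P g *P (const p₀ *P G′ (suc n))
      ≈⟨ ℤx.+-cong (ℤx.*-congˡ {d} (lucas-fibonacci (suc n))) (ℤx.*-congˡ {g} (lucas-fibonacci n)) ⟩
    d *P (p₁ *P G′ (suc n) +P G* (suc n)) +P g *P (p₁ *P G′ n +P G* n)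
      ≈⟨ collect p₁ d g (G′ (suc n)) (G′ n) (G* (suc n)) (G* n) ⟩
    p₁ *P (d *P G′ (suc n) +P g *P G′ n) +P (d *P G* (suc n) +P g *P G* n) ∎
    where
    open ≋-Reasoning
    distribute : ∀ c d g a b → c *P (d *P a +P g *P b) ≋ d *P (c *P a) +P g *P (c *P b)
    distribute = solve-∀ ring
    collect : ∀ p d g a b x y → d *P (p *P a +P x) +P g *P (p *P b +P y) ≋ p *P (d *P a +P g *P b) +P (d *P x +P g *P y)
    collect = solve-∀ ring

  p₀≢0 : p₀ ≢ + 0
  p₀≢0 p₀≡0 with subst (λ x → ∣ x ∣ ≡ 1 ⊎ ∣ x ∣ ≡ 2) p₀≡0 ∣p₀∣≤2
  ... | inj₁ ()
  ... | inj₂ ()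

  g⊥p₁ : Coprime g p₁
  g⊥p₁ = Coprime-∣ʳ (p₁∣d p₀ ∣p₀∣≤2 2p₁≈p₀d) (Coprime-sym d⊥g)

  g⊥dⁿ : ∀ n → Coprime g (d ^ n)
  g⊥dⁿ zero    = Coprime-sym (∣1⇒Coprime g ∣ʳ-refl)
  g⊥dⁿ (suc n) = Coprime-*ʳ (Coprime-sym d⊥g) (g⊥dⁿ n)

  G*-coprime-g : ∀ n → Coprime (G* (suc n)) g
  G*-coprime-g n {e} e∣G* e∣g with GFP-mod-g (const p₀) p₁ n
  ... | w , G*≈dⁿp₁+gw = Coprime-*ʳ (g⊥dⁿ n) g⊥p₁ e∣g e∣dⁿp₁
    where
    e∣dⁿp₁ : e ∣ d ^ n *P p₁
    e∣dⁿp₁ = ∣a+b∣b⇒∣a (∣ʳ-respʳ-≈ G*≈dⁿp₁+gw e∣G*) (∣-*Pʳ w e∣g)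

  G*-coprime-consecutive : ∀ n → Coprime (G* n) (G* (suc n))
  G*-coprime-consecutive zero    = p₀⊥p₁
  G*-coprime-consecutive (suc n) e∣G*₁₊ₙ e∣G*₂₊ₙ = G*-coprime-consecutive n e∣G*ₙ e∣G*₁₊ₙ
    where
    e∣G*ₙ = coprime-divisor (Coprime-∣ˡ e∣G*₁₊ₙ (G*-coprime-g n)) (∣a+b∣a⇒∣b e∣G*₂₊ₙ (x∣ʳy⇒x∣ʳzy d e∣G*₁₊ₙ))

  G*-via-G′ : ∀ m → G* (suc m) ≋ G′ (suc m) *P p₁ +P g *P G′ m *P const p₀
  G*-via-G′ m = ℤx.trans (ℤx.reflexive (cong G* (sym (ℕ.+-identityʳ (suc m))))) (GFP-addition (const p₀) p₁ m 0)

  sum-identityˡ : ∀ m n → const p₀ *P G′ (suc m + suc n) ≋ G′ (suc n) *P G* (suc m) +P G′ (suc m) *P G* (suc n)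
  sum-identityˡ m n = begin
    const p₀ *P G′ (suc m + suc n)
      ≈⟨ ℤx.*-congˡ {const p₀} (GFP-addition 0P 1P m (suc n)) ⟩
    const p₀ *P (G′ (suc m) *P G′ (suc (suc n)) +P g *P G′ m *P G′ (suc n))
      ≈⟨ regroup₁ (const p₀) (G′ (suc m)) (G′ (suc (suc n))) g (G′ m) (G′ (suc n)) ⟩
    G′ (suc m) *P (const p₀ *P G′ (suc (suc n))) +P G′ (suc n) *P (g *P G′ m *P const p₀)
      ≈⟨ ℤx.+-congʳ (ℤx.*-congˡ {G′ (suc m)} (lucas-fibonacci (suc n))) ⟩
    G′ (suc m) *P (p₁ *P G′ (suc n) +P G* (suc n)) +P G′ (suc n) *P (g *P G′ m *P const p₀)
      ≈⟨ regroup₂ (const p₀) p₁ (G′ (suc m)) g (G′ m) (G′ (suc n)) (G* (suc n)) ⟩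
    G′ (suc n) *P (G′ (suc m) *P p₁ +P g *P G′ m *P const p₀) +P G′ (suc m) *P G* (suc n)
      ≈⟨ ℤx.+-congʳ (ℤx.*-congˡ {G′ (suc n)} (G*-via-G′ m)) ⟨
    G′ (suc n) *P G* (suc m) +P G′ (suc m) *P G* (suc n) ∎
    where
    open ≋-Reasoning
    regroup₁ : ∀ c a b g x y → c *P (a *P b +P g *P x *P y) ≋ a *P (c *P b) +P y *P (g *P x *P c)
    regroup₁ = solve-∀ ring
    regroup₂ : ∀ c p a g x y z → a *P (p *P y +P z) +P y *P (g *P x *P c) ≋ y *P (a *P p +P g *P x *P c) +P a *P z
    regroup₂ = solve-∀ ring

  sum-identityʳ : ∀ m n → G′ (suc (suc n)) *P G* (suc m) ≋ p₁ *P G′ (suc m + suc n) +P g *P G′ m *P G* (suc n)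
  sum-identityʳ m n = begin
    G′ (suc (suc n)) *P G* (suc m)
      ≈⟨ ℤx.*-congˡ {G′ (suc (suc n))} (G*-via-G′ m) ⟩
    G′ (suc (suc n)) *P (G′ (suc m) *P p₁ +P g *P G′ m *P const p₀)
      ≈⟨ regroup₁ (G′ (suc (suc n))) (G′ (suc m)) p₁ g (G′ m) (const p₀) ⟩
    G′ (suc (suc n)) *P G′ (suc m) *P p₁ +P g *P G′ m *P (const p₀ *P G′ (suc (suc n)))
      ≈⟨ ℤx.+-congˡ {G′ (suc (suc n)) *P G′ (suc m) *P p₁} (ℤx.*-congˡ {g *P G′ m} (lucas-fibonacci (suc n))) ⟩
    G′ (suc (suc n)) *P G′ (suc m) *P p₁ +P g *P G′ m *P (p₁ *P G′ (suc n) +P G* (suc n))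
      ≈⟨ regroup₂ (G′ (suc (suc n))) (G′ (suc m)) p₁ g (G′ m) (G′ (suc n)) (G* (suc n)) ⟩
    p₁ *P (G′ (suc m) *P G′ (suc (suc n)) +P g *P G′ m *P G′ (suc n)) +P g *P G′ m *P G* (suc n)
      ≈⟨ ℤx.+-congʳ (ℤx.*-congˡ {p₁} (GFP-addition 0P 1P m (suc n))) ⟨
    p₁ *P G′ (suc m + suc n) +P g *P G′ m *P G* (suc n) ∎
    where
    open ≋-Reasoning
    regroup₁ : ∀ b a p g x c → b *P (a *P p +P g *P x *P c) ≋ b *P a *P p +P g *P x *P (c *P b)
    regroup₁ = solve-∀ ring
    regroup₂ : ∀ b a p g x y z → b *P a *P p +P g *P x *P (p *P y +P z) ≋ p *P (a *P b +P g *P x *P y) +P g *P x *P z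
    regroup₂ = solve-∀ ring

  same-common-divisors-sum : ∀ m n → SameCommonDivisors (G′ (suc m + suc n)) (G* (suc m)) (G* (suc n))
  same-common-divisors-sum m n {e} e∣G*ₙ₊₁ = mk⇔ e∣G′⇒e∣G* e∣G*⇒e∣G′
    where
    e∣gG′ₘG*ₙ₊₁ : e ∣ g *P G′ m *P G* (suc n)
    e∣gG′ₘG*ₙ₊₁ = x∣ʳy⇒x∣ʳzy (g *P G′ m) e∣G*ₙ₊₁
    e∣G*⇒e∣G′ : e ∣ G* (suc m) → e ∣ G′ (suc m + suc n)
    e∣G*⇒e∣G′ e∣G*ₘ₊₁ = ∣-cancel-scalar p₀≢0 p₀-primes-∤ᶜp₁ e∣p₀G′ e∣p₁G′
      where
      p₀-primes-∤ᶜp₁ : ∀ {p} → Prime p → p ∣ℕ ∣ p₀ ∣ → ¬ (p ∣ᶜ e × p ∣ᶜ p₁)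
      p₀-primes-∤ᶜp₁ p-prime p∣p₀ (_ , p∣p₁) = prime∤1P p-prime (p₀⊥p₁ (∣-abs⇒const∣ p∣p₀) (∣ᶜ⇒const∣ p∣p₁))
      e∣p₀G′ : e ∣ p₀ ·P G′ (suc m + suc n)
      e∣p₀G′ = ∣ʳ-respʳ-≈ (ℤx.trans (ℤx.sym (sum-identityˡ m n)) (ℤx.sym (·P≈const*P p₀ _)))
                          (∣-+P (x∣ʳy⇒x∣ʳzy (G′ (suc n)) e∣G*ₘ₊₁) (x∣ʳy⇒x∣ʳzy (G′ (suc m)) e∣G*ₙ₊₁))
      e∣p₁G′ : e ∣ p₁ *P G′ (suc m + suc n)
      e∣p₁G′ = ∣a+b∣b⇒∣a (∣ʳ-respʳ-≈ (sum-identityʳ m n) (x∣ʳy⇒x∣ʳzy (G′ (suc (suc n))) e∣G*ₘ₊₁))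
                         e∣gG′ₘG*ₙ₊₁
    e∣G′⇒e∣G* : e ∣ G′ (suc m + suc n) → e ∣ G* (suc m)
    e∣G′⇒e∣G* e∣G′ = ∣G′-consecutive⇒∣ (suc n) (G* (suc m)) (Coprime-∣ˡ e∣G*ₙ₊₁ (G*-coprime-g n)) e∣G′ₙ₊₁G* e∣G′ₙ₊₂G*
      where
      e∣G′ₙ₊₁G* : e ∣ G′ (suc n) *P G* (suc m)
      e∣G′ₙ₊₁G* = ∣a+b∣b⇒∣a (∣ʳ-respʳ-≈ (sum-identityˡ m n) (x∣ʳy⇒x∣ʳzy (const p₀) e∣G′))
                            (x∣ʳy⇒x∣ʳzy (G′ (suc m)) e∣G*ₙ₊₁)
      e∣G′ₙ₊₂G* : e ∣ G′ (suc (suc n)) *P G* (suc m)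
      e∣G′ₙ₊₂G* = ∣ʳ-respʳ-≈ (ℤx.sym (sum-identityʳ m n)) (∣-+P (x∣ʳy⇒x∣ʳzy p₁ e∣G′) e∣gG′ₘG*ₙ₊₁)

  reindex : ∀ {i i′ j j′ l l′} → i ≡ i′ → j ≡ j′ → l ≡ l′ →
            SameCommonDivisors (G′ i) (G* j) (G* l) → SameCommonDivisors (G′ i′) (G* j′) (G* l′)
  reindex refl refl refl same = same

  same-common-divisors-above : ∀ k n → SameCommonDivisors (G′ (suc k)) (G* (suc k + n)) (G* n)
  same-common-divisors-above k n {e} e∣G*ₙ = mk⇔ e∣G′⇒e∣G* e∣G*⇒e∣G′
    where
    G*≈ : G* (suc k + n) ≋ G′ (suc k) *P G* (suc n) +P g *P G′ k *P G* n
    G*≈ = GFP-addition (const p₀) p₁ k n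
    e∣gG′ₖG*ₙ : e ∣ g *P G′ k *P G* n
    e∣gG′ₖG*ₙ = x∣ʳy⇒x∣ʳzy (g *P G′ k) e∣G*ₙ
    e∣G′⇒e∣G* : e ∣ G′ (suc k) → e ∣ G* (suc k + n)
    e∣G′⇒e∣G* e∣G′ = ∣ʳ-respʳ-≈ (ℤx.sym G*≈) (∣-+P (∣-*Pʳ (G* (suc n)) e∣G′) e∣gG′ₖG*ₙ)
    e∣G*⇒e∣G′ : e ∣ G* (suc k + n) → e ∣ G′ (suc k)
    e∣G*⇒e∣G′ e∣G* = coprime-divisor (Coprime-∣ˡ e∣G*ₙ (G*-coprime-consecutive n))
      (∣ʳ-respʳ-≈ (ℤx.*-comm (G′ (suc k)) (G* (suc n)))
        (∣a+b∣b⇒∣a (∣ʳ-respʳ-≈ G*≈ e∣G*) e∣gG′ₖG*ₙ))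

  same-common-divisors-below : ∀ k m → SameCommonDivisors (G′ (suc k)) (G* m) (G* (suc k + m))
  same-common-divisors-below k m {e} e∣G*ₖ₊ₘ = mk⇔ e∣G′⇒e∣G* e∣G*⇒e∣G′
    where
    G*≈ : G* (suc k + m) ≋ G′ (suc k) *P G* (suc m) +P g *P G′ k *P G* m
    G*≈ = GFP-addition (const p₀) p₁ k m
    e∣G*⇒e∣G′ : e ∣ G* m → e ∣ G′ (suc k)
    e∣G*⇒e∣G′ e∣G* = coprime-divisor (Coprime-∣ˡ e∣G* (G*-coprime-consecutive m))
      (∣ʳ-respʳ-≈ (ℤx.*-comm (G′ (suc k)) (G* (suc m)))
        (∣a+b∣b⇒∣a (∣ʳ-respʳ-≈ G*≈ e∣G*ₖ₊ₘ) (x∣ʳy⇒x∣ʳzy (g *P G′ k) e∣G*)))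
    e∣G′⇒e∣G* : e ∣ G′ (suc k) → e ∣ G* m
    e∣G′⇒e∣G* e∣G′ = ∣G′-consecutive⇒∣ k (G* m) e⊥g e∣G′ₖG*ₘ (∣-*Pʳ (G* m) e∣G′)
      where
      e⊥g : Coprime e g
      e⊥g = Coprime-∣ˡ e∣G*ₖ₊ₘ (G*-coprime-g (k + m))
      e∣gG′ₖG*ₘ : e ∣ g *P (G′ k *P G* m)
      e∣gG′ₖG*ₘ = ∣ʳ-respʳ-≈ (ℤx.*-assoc g (G′ k) (G* m))
        (∣a+b∣a⇒∣b (∣ʳ-respʳ-≈ G*≈ e∣G*ₖ₊ₘ) (∣-*Pʳ (G* (suc m)) e∣G′))
      e∣G′ₖG*ₘ : e ∣ G′ k *P G* m
      e∣G′ₖG*ₘ = coprime-divisor e⊥g e∣gG′ₖG*ₘ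

∣P⇒∣ : ∀ {a b} → a ∣P b → a ∣ b
∣P⇒∣ (c , ca≈b) = c , mk≋ ca≈b

∣⇒∣P : ∀ {a b} → a ∣ b → a ∣P b
∣⇒∣P (c , mk≋ ca≈b) = c , ca≈b

IsGCD-1P⇒Coprime : ∀ {a b} → IsGCD a b 1P → Coprime a b
IsGCD-1P⇒Coprime (_ , _ , greatest) e∣a e∣b = ∣P⇒∣ (greatest _ (∣⇒∣P e∣a) (∣⇒∣P e∣b))

SameCommonDivisors⇒SameGCD : ∀ {a b c} → SameCommonDivisors a b c → SameGCD a c b c
SameCommonDivisors⇒SameGCD {a} {b} {c} same h = transfer same , transfer (⇔-sym ∘ same)
  where
  transfer : ∀ {x y} → SameCommonDivisors x y c → IsGCD x c h → IsGCD y c h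
  transfer x~y (h∣x , h∣c , greatest) =
    ∣⇒∣P (Equivalence.to (x~y (∣P⇒∣ h∣c)) (∣P⇒∣ h∣x)) , h∣c ,
    λ e e∣y e∣c → greatest e (∣⇒∣P (Equivalence.from (x~y (∣P⇒∣ e∣c)) (∣P⇒∣ e∣y))) e∣c

proposition17 : (p0 : ℤ) (p1 d g : Poly) → GFPParams d g → LucasType p0 p1 d g →
  (m n : ℕ) → 0 < m → 0 < n →
    SameGCD (Gprime d g (m + n + 1)) (Gstar p0 p1 d g n) (Gstar p0 p1 d g (m + 1)) (Gstar p0 p1 d g n)
    × (m > n → SameGCD (Gprime d g (m ∸ n + 1)) (Gstar p0 p1 d g n) (Gstar p0 p1 d g (m + 1)) (Gstar p0 p1 d g n))
    × (m < n → SameGCD (Gprime d g (n ∸ m + 1)) (Gstar p0 p1 d g n) (Gstar p0 p1 d g (m ∸ 1)) (Gstar p0 p1 d g n))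
-- Only gcd(d, g) = 1, 2p₁ = p₀d, |p₀| ∈ {1, 2} and gcd(p₀, p₁) = 1 are used.
proposition17 p0 p1 d g (_ , _ , d⊥g , _) (_ , _ , 2p₁≈p₀d , ∣p₀∣≤2 , p₀⊥p₁ , _ , _) m@(suc m′) n@(suc n′) _ _ =
  SameCommonDivisors⇒SameGCD sum-case ,
  (λ m>n → SameCommonDivisors⇒SameGCD (above-case m>n)) ,
  (λ m<n → SameCommonDivisors⇒SameGCD (below-case m<n))
  where
  open GeneralizedFibonacci d g
  open LucasSequence p0 p1 d g (mk≋ 2p₁≈p₀d) ∣p₀∣≤2 (IsGCD-1P⇒Coprime d⊥g) (IsGCD-1P⇒Coprime p₀⊥p₁)
  +1≡suc : ∀ i → i + 1 ≡ suc i
  +1≡suc i = ℕ.+-comm i 1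
  sum-case : SameCommonDivisors (G′ (m + n + 1)) (G* (m + 1)) (G* n)
  sum-case = reindex (sym (+1≡suc (m + n))) (sym (+1≡suc m)) (refl {x = n}) (same-common-divisors-sum m n′)
  above-case : m > n → SameCommonDivisors (G′ (m ∸ n + 1)) (G* (m + 1)) (G* n)
  above-case m>n =
    reindex (sym (+1≡suc (m ∸ n))) (trans (cong suc (ℕ.m∸n+n≡m (ℕ.<⇒≤ m>n))) (sym (+1≡suc m))) (refl {x = n})
            (same-common-divisors-above (m ∸ n) n)
  below-case : m < n → SameCommonDivisors (G′ (n ∸ m + 1)) (G* (m ∸ 1)) (G* n)
  below-case m<n =
    reindex (sym (+1≡suc (n ∸ m))) (refl {x = m′}) (trans (sym (ℕ.+-suc (n ∸ m) m′)) (ℕ.m∸n+n≡m (ℕ.<⇒≤ m<n)))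
            (same-common-divisors-below (n ∸ m) m′)
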